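{- Let $n\ge1$ and $\sigma\in S_n$ with $\sigma(1)=1$, and let $\lambda_d$ be the number of $d$-cycles of $\sigma$ (fixed points being $1$-cycles). For $d\ge1$ let $\Lambda_d=\{i\in[n]:\sigma^d(i)=i\}$; for $d\ge2$ let $\Lambda'_d=\{i\in[n]:\sigma^e(i)=i\text{ for some } e\mid d,\ e<d\}$, and let $\Lambda'_1=\{1\}$. Define a $\sigma$-Prüfer sequence to be a concatenation $B_1B_2\cdots B_n$ of blocks, where $B_1$ is a sequence of length $\lambda_1-1$ and, for $d\ge2$, $B_d$ is a sequence of length $\lambda_d$, such that every entry of $B_d$ lies in $\Lambda_d$ and, if $B_d$ is nonempty, its last entry lies in $\Lambda'_d$. (So the total length is $(\lambda_1-1)+\lambda_2+\dots+\lambda_n$, one less than the number of cycles of $\sigma$.) Then there is a bijection between $\sigma$-Prüfer sequences and labeled trees on $[n]$ rooted at $1$ that are $\sigma$-invariant.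
   Context: A labeled tree on $[n]$ rooted at $1$ is a spanning tree on vertex set $[n]$ with root $1$; it is $\sigma$-invariant if $\sigma$ maps every edge $\{i,j\}$ to an edge $\{\sigma(i),\sigma(j)\}$ of the tree. -}

module Defs where

open import Data.Nat as ℕ using (ℕ; zero; suc; _∸_; _≤_; _<_)
open import Data.Nat.Divisibility using (_∣_)
open import Data.Fin as Fin using (Fin; toℕ)
open import Data.Fin.Permutation using (Permutation′; _⟨$⟩ʳ_)
open import Data.Bool using (Bool; T)
open import Data.List using (List; []; _∷_; _++_; [_]; length)
open import Data.List.Relation.Unary.Linked using (Linked)
open import Data.List.Relation.Unary.Unique.Propositional using (Unique)
open import Data.List.Relation.Unary.All using (All)
open import Data.Vec as Vec using (Vec)
open import Data.Product using (Σ; _×_; ∃; _,_)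
open import Data.Product.Properties using ()
open import Relation.Nullary.Decidable using (_×-dec_; _→-dec_; ¬?)
import Relation.Nullary.Decidable as ND
open import Data.Sum using (_⊎_; inj₁; inj₂)
open import Data.Vec.Relation.Unary.All using () renaming (All to VAll)
open import Data.List using (allFin)
open import Data.Empty using (⊥)
open import Data.Unit using (⊤)
open import Relation.Nullary using (¬_)
open import Relation.Binary using (Setoid; IsEquivalence)
open import Relation.Binary.PropositionalEquality as ≡ using (_≡_)
open import Data.List using (filter) renaming (length to len)
open import Data.Fin.Properties using (_≟_; _≤?_)
open import Data.Nat.Properties as ℕP using ()
open import Relation.Nullary.Decidable using (Dec; yes; no)

-- Vertex set [n] is Fin n; label i+1 is represented by (i : Fin n).
-- So vertex 1 (the root) is Fin.zero, and we take n = suc m (n ≥ 1).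

_^[_]_ : ∀ {n} → Permutation′ n → ℕ → Fin n → Fin n
σ ^[ zero ] i = i
σ ^[ suc d ] i = σ ⟨$⟩ʳ (σ ^[ d ] i)

IsCycleRep : ∀ {n} → Permutation′ n → ℕ → Fin n → Set
IsCycleRep σ d i =
  (1 ≤ d) × (σ ^[ d ] i ≡ i)
  × ((∀ e → 1 ≤ e → e < d → ¬ (σ ^[ e ] i ≡ i))
  × (∀ e → e < d → i Fin.≤ σ ^[ e ] i))

allBelow : (d : ℕ) (P : ℕ → Set) → (∀ e → Dec (P e)) → Dec (∀ e → e < d → P e)
allBelow zero P p = yes (λ e ())
allBelow (suc d) P p with allBelow d P p | p d
... | no ¬h | _ = no (λ h → ¬h (λ e e<d → h e (ℕP.m<n⇒m<1+n e<d)))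
... | yes h | no ¬pd = no (λ h' → ¬pd (h' d ℕP.≤-refl))
... | yes h | yes pd = yes (λ e e<sd → aux e (ℕP.m<1+n⇒m<n∨m≡n e<sd))
  where
  aux : ∀ e → (e < d) ⊎ (e ≡ d) → P e
  aux e (inj₁ e<d) = h e e<d
  aux e (inj₂ ≡.refl) = pd

isCycleRep? : ∀ {n} (σ : Permutation′ n) d i → Dec (IsCycleRep σ d i)
isCycleRep? σ d i =
  (1 ℕ.≤? d) ×-dec ((σ ^[ d ] i ≟ i) ×-dec
    (ND.map′ (λ h e a b → h e b a) (λ h e b a → h e a b)
      (allBelow d (λ e → 1 ≤ e → ¬ (σ ^[ e ] i ≡ i))
        (λ e → (1 ℕ.≤? e) →-dec (¬? (σ ^[ e ] i ≟ i))))
     ×-dec allBelow d (λ e → i Fin.≤ σ ^[ e ] i) (λ e → i ≤? σ ^[ e ] i)))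

-- λ_d : the number of d-cycles of σ (counted via their minimal elements)
cycleCount : ∀ {n} → Permutation′ n → ℕ → ℕ
cycleCount {n} σ d = len (filter (isCycleRep? σ d) (allFin n))

InΛ : ∀ {n} → Permutation′ n → ℕ → Fin n → Set
InΛ σ d i = σ ^[ d ] i ≡ i

InΛ′ : ∀ {n} → Permutation′ (suc n) → ℕ → Fin (suc n) → Set
InΛ′ σ 1 i = i ≡ Fin.zero
InΛ′ σ d i = ∃ λ e → (e ∣ d) × (e < d) × (σ ^[ e ] i ≡ i)

-- σ-Prüfer sequences.  Blocks are indexed by k : Fin n, standing for
-- d = k + 1 ∈ {1,…,n}.

blockLen : ∀ {n} → Permutation′ n → ℕ → ℕ
blockLen σ 1 = cycleCount σ 1 ∸ 1
blockLen σ d = cycleCount σ d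

lastEntry : ∀ {A : Set} {l} → Vec A (suc l) → A
lastEntry = Vec.last

ValidBlock : ∀ {n} (σ : Permutation′ (suc n)) (d : ℕ) {l : ℕ} →
             Vec (Fin (suc n)) l → Set
ValidBlock σ d {zero} B = ⊤
ValidBlock σ d {suc l} B =
  VAll (InΛ σ d) B × InΛ′ σ d (Vec.last B)

Blocks : ∀ {n} → Permutation′ (suc n) → Set
Blocks {n} σ = (k : Fin (suc n)) → Vec (Fin (suc n)) (blockLen σ (suc (toℕ k)))

record PruferSeq {n} (σ : Permutation′ (suc n)) : Set where
  field
    blocks : Blocks σ
    valid  : ∀ k → ValidBlock σ (suc (toℕ k)) (blocks k)

PruferSetoid : ∀ {n} → Permutation′ (suc n) → Setoid _ _
PruferSetoid σ = record
  { Carrier = PruferSeq σ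
  ; _≈_ = λ s t → ∀ k → PruferSeq.blocks s k ≡ PruferSeq.blocks t k
  ; isEquivalence = record
    { refl = λ k → ≡.refl
    ; sym = λ p k → ≡.sym (p k)
    ; trans = λ p q k → ≡.trans (p k) (q k) } }

Adj : ℕ → Set
Adj n = Fin n → Fin n → Bool

data Walk {n} (E : Adj n) : Fin n → Fin n → Set where
  here  : ∀ {u} → Walk E u u
  step  : ∀ {u v w} → T (E u v) → Walk E v w → Walk E u w

Connected : ∀ {n} → Adj n → Set
Connected E = ∀ u v → Walk E u v

HasCycle : ∀ {n} → Adj n → Set
HasCycle {n} E = Σ (Fin n) λ x → Σ (List (Fin n)) λ vs →
  (2 ≤ length vs) × Unique (x ∷ vs) × Linked (λ a b → T (E a b)) (x ∷ vs ++ [ x ])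

record IsSpanningTree {n} (E : Adj n) : Set where
  field
    symmetric  : ∀ i j → E i j ≡ E j i
    irreflexive : ∀ i → ¬ T (E i i)
    connected  : Connected E
    acyclic    : ¬ HasCycle E

Invariant : ∀ {n} → Permutation′ n → Adj n → Set
Invariant σ E = ∀ i j → T (E i j) → T (E (σ ⟨$⟩ʳ i) (σ ⟨$⟩ʳ j))

-- labeled trees on [n] rooted at 1 (= Fin.zero) that are σ-invariant.
-- The root is fixed to be vertex 1 for all of them, so a rooted tree is
-- determined by its edge set.
record InvariantTree {n} (σ : Permutation′ (suc n)) : Set where
  field
    edges     : Adj (suc n)
    isTree    : IsSpanningTree edges
    invariant : Invariant σ edges

TreeSetoid : ∀ {n} → Permutation′ (suc n) → Setoid _ _
TreeSetoid σ = record
  { Carrier = InvariantTree σ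
  ; _≈_ = λ s t → ∀ i j → InvariantTree.edges s i j ≡ InvariantTree.edges t i j
  ; isEquivalence = record
    { refl = λ i j → ≡.refl
    ; sym = λ p i j → ≡.sym (p i j)
    ; trans = λ p q i j → ≡.trans (p i j) (q i j) } }

-- A rooted tree is the same as a parent function that strictly decreases some depth, and the tree is
-- σ-invariant exactly when its parent function commutes with σ. Such a function is determined by the
-- parents of the cycle representatives (the minimal elements of the non-root cycles of σ), and the
-- parent of the representative of a d-cycle must be fixed by σᵈ, i.e. lie in Λ_d. For each d the
-- non-root d-cycles form a forest, a cycle being the child of the cycle of its parent when that is
-- again a d-cycle; the roots of this forest hang from Λ′_d (shorter cycles, or the root when d = 1).
-- Its Prüfer code, with values read through the cycle representatives, is the block B_d: one entry in
-- Λ_d per d-cycle, the last one in Λ′_d. The depth (cycle length, Prüfer rank), ordered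
-- lexicographically, shows that the parent function assembled from all blocks is acyclic.

module Submission where

open import Defs
open import Data.Nat as ℕ using (ℕ; zero; suc; _+_; _*_; _∸_; _≤_; _<_; z≤n; s≤s; _%_; _/_)
open import Data.Nat.Properties as ℕP using ()
open import Data.Nat.DivMod using (_mod_; m≡m%n+[m/n]*n; m%n<n; m<n⇒m%n≡m)
open import Data.Nat.Divisibility using (_∣_; ∣⇒≤; divides; 0∣⇒≡0; m%n≡0⇒n∣m)
open import Data.Nat.Induction using (<-wellFounded)
open import Data.Bool using (Bool; true; false; T)
open import Data.Empty using (⊥)
open import Data.Unit using (⊤; tt)
open import Data.Fin as Fin using (Fin; toℕ)
open import Data.Fin.Properties as FinP using (_≟_)
open import Data.Fin.Permutation using (Permutation′; _⟨$⟩ʳ_)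
open import Data.List as List using (List; []; _∷_; _++_; [_]; length; map; filter; tabulate; upTo)
open import Data.List.Properties using (++-assoc; unfold-reverse; length-++; length-map; map-id; map-cong-local; length-filter; length-tabulate; filter-accept; filter-reject)
open import Data.List.Extrema.Nat using (argmin; argmax; f[argmin]≤f[xs]; argmin-sel; f[⊥]≤f[argmax]; f[xs]≤f[argmax]; argmax-sel)
open import Data.List.Membership.Propositional using (_∈_; _∉_)
open import Data.List.Membership.Propositional.Properties using (∈-∃++; ∈-++⁺ˡ; ∈-++⁺ʳ; ∈-++⁻; ∈-map⁺; ∈-map⁻; ∈-upTo⁺; ∈-upTo⁻; ∈-filter⁺; ∈-filter⁻; ∈-tabulate⁺; ∈-tabulate⁻)
open import Data.List.Relation.Binary.Subset.Propositional using (_⊆_)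
open import Data.List.Relation.Binary.Permutation.Propositional using (_↭_; ↭-sym; ↭⇒↭ₛ)
open import Data.List.Relation.Binary.Permutation.Propositional.Properties using (shift; ∈-resp-↭; ↭-length; ↭-reverse)
import Data.List.Relation.Binary.Permutation.Setoid.Properties as ↭ₛ
open import Data.List.Relation.Unary.Any using (here; there)
open import Data.List.Relation.Unary.All as All using (All; []; _∷_)
import Data.List.Relation.Unary.All.Properties as AllP
open import Data.List.Relation.Unary.AllPairs as AllPairs using ([]; _∷_)
open import Data.List.Relation.Unary.Linked as Linked using (Linked; []; [-]; _∷_)
open import Data.List.Relation.Unary.Linked.Properties using (Linked⇒AllPairs)
open import Data.List.Relation.Unary.Unique.Propositional using (Unique)
import Data.List.Relation.Unary.Unique.Propositional.Properties as Unique
open import Data.Vec as Vec using (Vec; []; _∷_; toList)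
open import Data.Vec.Properties using (length-toList)
import Data.Vec.Relation.Unary.All.Properties as VAll
open import Data.Maybe using (Maybe; just; nothing)
open import Data.Product using (Σ; ∃; _×_; _,_; proj₁; proj₂)
open import Data.Sum as Sum using (_⊎_; inj₁; inj₂; swap)
open import Function using (_∘_; id)
open import Function.Bundles using (Inverse; module Injection)
open import Function.Properties.Inverse using (↔⇒↣)
import Function.Construct.Composition as Compose
open import Induction.WellFounded using (Acc; acc)
open import Relation.Nullary using (¬_; Dec; yes; no; contradiction)
open import Relation.Nullary.Decidable using (⌊_⌋; _⊎-dec_; _×-dec_; ¬?; toWitness; fromWitness; decidable-stable)
open import Relation.Unary using (Decidable)
open import Relation.Binary using (Setoid; DecidableEquality; tri<; tri≈; tri>)
open import Relation.Binary.PropositionalEquality using (_≡_; _≢_; refl; sym; trans; cong; cong₂; subst; subst₂; setoid; module ≡-Reasoning)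

module _ {A : Set} where

  Unique-++⁻ˡ : ∀ xs {ys : List A} → Unique (xs ++ ys) → Unique xs
  Unique-++⁻ˡ []       _        = []
  Unique-++⁻ˡ (x ∷ xs) (p ∷ u) = AllP.++⁻ˡ xs p ∷ Unique-++⁻ˡ xs u

  Unique-++⁻ʳ : ∀ xs {ys : List A} → Unique (xs ++ ys) → Unique ys
  Unique-++⁻ʳ []       u       = u
  Unique-++⁻ʳ (x ∷ xs) (_ ∷ u) = Unique-++⁻ʳ xs u

  Unique-++⇒∉ : ∀ xs {ys : List A} → Unique (xs ++ ys) → ∀ {x} → x ∈ xs → x ∉ ys
  Unique-++⇒∉ (x ∷ xs) (p ∷ _) (here refl) x∈ys = All.lookup (AllP.++⁻ʳ xs p) x∈ys refl
  Unique-++⇒∉ (x ∷ xs) (_ ∷ u) (there x∈xs)   = Unique-++⇒∉ xs u x∈xs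

  length≡0⇒∉ : ∀ {xs : List A} {x} → length xs ≡ 0 → x ∉ xs
  length≡0⇒∉ {[]} _ ()

  ↭-middle : ∀ pre {post : List A} x → pre ++ x ∷ post ↭ x ∷ pre ++ post
  ↭-middle pre {post} x = shift x pre post

  ∈-middle⁺ : ∀ pre {post : List A} {x y} → y ∈ pre ++ post → y ∈ pre ++ x ∷ post
  ∈-middle⁺ pre {x = x} y∈ = ∈-resp-↭ (↭-sym (↭-middle pre x)) (there y∈)

  ∈-middle⁻ : ∀ pre {post : List A} {x y} → y ∈ pre ++ x ∷ post → y ≡ x ⊎ y ∈ pre ++ post
  ∈-middle⁻ pre {x = x} y∈ with ∈-resp-↭ (↭-middle pre x) y∈
  ... | here y≡x = inj₁ y≡x
  ... | there y∈′ = inj₂ y∈′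

  Unique-resp-↭ : ∀ {xs ys : List A} → xs ↭ ys → Unique xs → Unique ys
  Unique-resp-↭ xs↭ys = ↭ₛ.Unique-resp-↭ (setoid A) (↭⇒↭ₛ xs↭ys)

  Unique-middle⁻ : ∀ pre {post : List A} {x} → Unique (pre ++ x ∷ post) → Unique (pre ++ post)
  Unique-middle⁻ pre {x = x} unique with Unique-resp-↭ (↭-middle pre x) unique
  ... | _ ∷ unique′ = unique′

  ∈-middle⇒≢ : ∀ pre {post : List A} {x y} → Unique (pre ++ x ∷ post) → y ∈ pre ++ post → y ≢ x
  ∈-middle⇒≢ pre {x = x} unique y∈ refl = Unique.Unique[x∷xs]⇒x∉xs (Unique-resp-↭ (↭-middle pre x) unique) y∈

  length-middle : ∀ pre {post : List A} {x} → length (pre ++ x ∷ post) ≡ suc (length (pre ++ post))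
  length-middle pre {x = x} = ↭-length (↭-middle pre x)

  Unique⇒length≤ : ∀ {xs ys : List A} → Unique xs → xs ⊆ ys → length xs ≤ length ys
  Unique⇒length≤ {[]}     _          _  = z≤n
  Unique⇒length≤ {x ∷ xs} (x∉ ∷ u) xs⊆ys with ∈-∃++ (xs⊆ys (here refl))
  ... | pre , post , refl = subst (suc (length xs) ≤_) (sym (length-middle pre))
          (s≤s (Unique⇒length≤ u xs⊆pre++post))
    where
    xs⊆pre++post : xs ⊆ pre ++ post
    xs⊆pre++post {y} y∈xs with ∈-middle⁻ pre (xs⊆ys (there y∈xs))
    ... | inj₁ refl = contradiction refl (All.lookup x∉ y∈xs)
    ... | inj₂ y∈   = y∈

  firstSplit : {P : A → Set} → Decidable P → List A → Maybe (List A × A × List A)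
  firstSplit P? [] = nothing
  firstSplit P? (x ∷ xs) with P? x | firstSplit P? xs
  ... | yes _ | _                       = just ([] , x , xs)
  ... | no _  | just (pre , y , post)   = just (x ∷ pre , y , post)
  ... | no _  | nothing                 = nothing

  firstSplit-just : ∀ {P : A → Set} (P? : Decidable P) xs {pre y post} →
    firstSplit P? xs ≡ just (pre , y , post) → xs ≡ pre ++ y ∷ post × P y
  firstSplit-just P? (x ∷ xs) eq with P? x | firstSplit P? xs in eq′
  firstSplit-just P? (x ∷ xs) refl | yes px | _ = refl , px
  firstSplit-just P? (x ∷ xs) refl | no _ | just _ with firstSplit-just P? xs eq′
  ... | refl , py = refl , py

  firstSplit-nothing : ∀ {P : A → Set} (P? : Decidable P) xs →
    firstSplit P? xs ≡ nothing → ∀ {x} → x ∈ xs → ¬ P x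
  firstSplit-nothing P? (x ∷ xs) eq x∈ with P? x | firstSplit P? xs in eq′
  firstSplit-nothing P? (x ∷ xs) refl (here refl) | no ¬px | nothing = ¬px
  firstSplit-nothing P? (x ∷ xs) refl (there x∈) | no ¬px | nothing = firstSplit-nothing P? xs eq′ x∈

  firstSplit-cong : ∀ {P Q : A → Set} (P? : Decidable P) (Q? : Decidable Q) xs →
    (∀ {x} → x ∈ xs → P x → Q x) → (∀ {x} → x ∈ xs → Q x → P x) →
    firstSplit P? xs ≡ firstSplit Q? xs
  firstSplit-cong P? Q? [] _ _ = refl
  firstSplit-cong P? Q? (x ∷ xs) P⇒Q Q⇒P
    with P? x | Q? x | firstSplit-cong P? Q? xs (P⇒Q ∘ there) (Q⇒P ∘ there)
  ... | yes _  | yes _  | _ = refl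
  ... | yes px | no ¬qx | _ = contradiction (P⇒Q (here refl) px) ¬qx
  ... | no ¬px | yes qx | _ = contradiction (Q⇒P (here refl) qx) ¬px
  ... | no _   | no _   | eq rewrite eq with firstSplit Q? xs
  ...   | just _  = refl
  ...   | nothing = refl

second : {A : Set} → A → List A → A
second _ (_ ∷ y ∷ _) = y
second d _           = d

second-map : ∀ {A B : Set} (f : A → B) d xs → second (f d) (map f xs) ≡ f (second d xs)
second-map f d []          = refl
second-map f d (_ ∷ [])    = refl
second-map f d (_ ∷ _ ∷ _) = refl

-- Cycles of a permutation

least : (P : ℕ → Set) → (∀ k → Dec (P k)) → ∀ w → P w →
  Σ ℕ λ k → P k × k ≤ w × (∀ j → j < k → ¬ P j)
least P P? w pw with P? 0
... | yes p0 = 0 , p0 , z≤n , λ _ ()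
... | no ¬p0 with w
...   | zero = contradiction pw ¬p0
...   | suc w′ with least (λ k → P (suc k)) (λ k → P? (suc k)) w′ pw
...     | k , pk , k≤w′ , below = suc k , pk , s≤s k≤w′ , below′
  where
  below′ : ∀ j → j < suc k → ¬ P j
  below′ zero    _         = ¬p0
  below′ (suc j) (s≤s j<k) = below j j<k

module Orbits {n : ℕ} (σ : Permutation′ n) where

  σ-injective : ∀ {i j} → σ ⟨$⟩ʳ i ≡ σ ⟨$⟩ʳ j → i ≡ j
  σ-injective = Injection.injective (↔⇒↣ σ)

  ^-+ : ∀ a b i → σ ^[ a + b ] i ≡ σ ^[ a ] (σ ^[ b ] i)
  ^-+ zero    b i = refl
  ^-+ (suc a) b i = cong (σ ⟨$⟩ʳ_) (^-+ a b i)

  ^-injective : ∀ a {i j} → σ ^[ a ] i ≡ σ ^[ a ] j → i ≡ j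
  ^-injective zero    eq = eq
  ^-injective (suc a) eq = ^-injective a (σ-injective eq)

  ^-comm : ∀ a b i → σ ^[ a ] (σ ^[ b ] i) ≡ σ ^[ b ] (σ ^[ a ] i)
  ^-comm a b i = begin
    σ ^[ a ] (σ ^[ b ] i)  ≡⟨ ^-+ a b i ⟨
    σ ^[ a + b ] i         ≡⟨ cong (λ k → σ ^[ k ] i) (ℕP.+-comm a b) ⟩
    σ ^[ b + a ] i         ≡⟨ ^-+ b a i ⟩
    σ ^[ b ] (σ ^[ a ] i)  ∎
    where open ≡-Reasoning

  ^-∸ : ∀ {a b} i → a ≤ b → σ ^[ b ∸ a ] (σ ^[ a ] i) ≡ σ ^[ b ] i
  ^-∸ {a} {b} i a≤b = trans (sym (^-+ (b ∸ a) a i)) (cong (λ k → σ ^[ k ] i) (ℕP.m∸n+n≡m a≤b))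

  ^-*-fixed : ∀ k {d x} → σ ^[ d ] x ≡ x → σ ^[ k * d ] x ≡ x
  ^-*-fixed zero    _         = refl
  ^-*-fixed (suc k) {d} {x} fix = trans (^-+ d (k * d) x) (trans (cong (σ ^[ d ]_) (^-*-fixed k fix)) fix)

  ^-%-fixed : ∀ a {d x} → σ ^[ suc d ] x ≡ x → σ ^[ a ] x ≡ σ ^[ a % suc d ] x
  ^-%-fixed a {d} {x} fix = begin
    σ ^[ a ] x                                   ≡⟨ cong (λ k → σ ^[ k ] x) (m≡m%n+[m/n]*n a (suc d)) ⟩
    σ ^[ a % suc d + a / suc d * suc d ] x       ≡⟨ ^-+ (a % suc d) _ x ⟩
    σ ^[ a % suc d ] (σ ^[ a / suc d * suc d ] x) ≡⟨ cong (σ ^[ a % suc d ]_) (^-*-fixed (a / suc d) fix) ⟩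
    σ ^[ a % suc d ] x                           ∎
    where open ≡-Reasoning

  Returns : Fin n → ℕ → Set
  Returns v e = 1 ≤ e × σ ^[ e ] v ≡ v

  returns? : ∀ v e → Dec (Returns v e)
  returns? v e = (1 ℕ.≤? e) ×-dec (σ ^[ e ] v ≟ v)

  -- Among v, σ v, …, σⁿ v two agree, and σ is injective.
  returns-≤n : ∀ v → ∃ λ e → Returns v e × e ≤ n
  returns-≤n v with FinP.pigeonhole (ℕP.n<1+n n) (λ (j : Fin (suc n)) → σ ^[ toℕ j ] v)
  ... | i , j , i<j , eq = toℕ j ∸ toℕ i , (ℕP.m<n⇒0<n∸m i<j , returns) ,
                          ℕP.≤-trans (ℕP.m∸n≤m (toℕ j) (toℕ i)) (ℕP.≤-pred (FinP.toℕ<n j))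
    where
    returns : σ ^[ toℕ j ∸ toℕ i ] v ≡ v
    returns = ^-injective (toℕ i) (begin
      σ ^[ toℕ i ] (σ ^[ toℕ j ∸ toℕ i ] v)  ≡⟨ ^-comm (toℕ i) (toℕ j ∸ toℕ i) v ⟩
      σ ^[ toℕ j ∸ toℕ i ] (σ ^[ toℕ i ] v)  ≡⟨ ^-∸ v (ℕP.<⇒≤ i<j) ⟩
      σ ^[ toℕ j ] v                         ≡⟨ eq ⟨
      σ ^[ toℕ i ] v                         ∎)
      where open ≡-Reasoning

  module CycleMinimum (v : Fin n) (d : ℕ) (σᵈv : σ ^[ suc d ] v ≡ v)
                      (below : ∀ j → j < suc d → ¬ Returns v j) where

    label : ℕ → ℕ
    label j = toℕ (σ ^[ j ] v)

    a : ℕ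
    a = argmin label 0 (upTo (suc d))

    a<d : a < suc d
    a<d with argmin-sel label 0 (upTo (suc d))
    ... | inj₁ a≡0 = subst (_< suc d) (sym a≡0) (s≤s z≤n)
    ... | inj₂ a∈  = ∈-upTo⁻ a∈

    a-minimal : ∀ {j} → j < suc d → label a ≤ label j
    a-minimal j<d = All.lookup (f[argmin]≤f[xs] {f = label} 0 (upTo (suc d))) (∈-upTo⁺ j<d)

    r : Fin n
    r = σ ^[ a ] v

    r-isRep : IsCycleRep σ (suc d) r
    r-isRep = s≤s z≤n , returns , noEarlier , minimal
      where
      returns : σ ^[ suc d ] r ≡ r
      returns = trans (^-comm (suc d) a v) (cong (σ ^[ a ]_) σᵈv)
      noEarlier : ∀ e → 1 ≤ e → e < suc d → ¬ σ ^[ e ] r ≡ r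
      noEarlier e 1≤e e<d σᵉr≡r = below e e<d (1≤e , ^-injective a (trans (^-comm a e v) σᵉr≡r))
      minimal : ∀ e → e < suc d → r Fin.≤ σ ^[ e ] r
      minimal e _ = subst (λ t → toℕ r ≤ toℕ t)
        (trans (sym (^-%-fixed (e + a) σᵈv)) (^-+ e a v)) (a-minimal (m%n<n (e + a) (suc d)))

    r-reaches : σ ^[ suc d ∸ a ] r ≡ v
    r-reaches = trans (^-∸ v (ℕP.<⇒≤ a<d)) σᵈv

  record CycleOf (v : Fin n) : Set where
    field
      rep      : Fin n
      period   : ℕ
      offset   : ℕ
      isRep    : IsCycleRep σ period rep
      reaches  : σ ^[ offset ] rep ≡ v
      period≤n : period ≤ n

  opaque
    cycleOf : ∀ v → CycleOf v
    cycleOf v with returns-≤n v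
    ... | w , ret , w≤n with least (Returns v) (returns? v) w ret
    ...   | zero  , (() , _) , _
    ...   | suc d , (_ , σᵈv) , d≤w , below = record
      { rep = r ; period = suc d ; offset = suc d ∸ a ; isRep = r-isRep ; reaches = r-reaches
      ; period≤n = ℕP.≤-trans d≤w w≤n }
      where open CycleMinimum v d σᵈv below

  rep-minimal : ∀ {d r} → IsCycleRep σ d r → ∀ j → r Fin.≤ σ ^[ j ] r
  rep-minimal {suc d} {r} (_ , fix , _ , minimal) j =
    subst (λ t → r Fin.≤ t) (sym (^-%-fixed j fix)) (minimal (j % suc d) (m%n<n j (suc d)))

  cycle-closes : ∀ {d r} → IsCycleRep σ d r → ∀ j → ∃ λ k → σ ^[ k ] (σ ^[ j ] r) ≡ r
  cycle-closes {suc d} {r} (_ , fix , _) j = j * suc d ∸ j , (begin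
    σ ^[ j * suc d ∸ j ] (σ ^[ j ] r) ≡⟨ ^-∸ r (ℕP.m≤m*n j (suc d)) ⟩
    σ ^[ j * suc d ] r                 ≡⟨ ^-*-fixed j fix ⟩
    r                                  ∎)
    where open ≡-Reasoning

  cycle-distinct : ∀ {d r a b} → IsCycleRep σ d r → a < b → b < d → σ ^[ a ] r ≢ σ ^[ b ] r
  cycle-distinct {d} {r} {a} {b} (_ , _ , noEarlier , _) a<b b<d eq =
    noEarlier (b ∸ a) (ℕP.m<n⇒0<n∸m a<b) (ℕP.≤-<-trans (ℕP.m∸n≤m b a) b<d)
      (^-injective a (trans (^-comm a (b ∸ a) r) (trans (^-∸ r (ℕP.<⇒≤ a<b)) (sym eq))))

  ^-injective-below : ∀ {d r a b} → IsCycleRep σ d r → a < d → b < d → σ ^[ a ] r ≡ σ ^[ b ] r → a ≡ b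
  ^-injective-below {a = a} {b} r-isRep a<d b<d eq with ℕP.<-cmp a b
  ... | tri< a<b _ _ = contradiction eq (cycle-distinct r-isRep a<b b<d)
  ... | tri≈ _ a≡b _ = a≡b
  ... | tri> _ _ b<a = contradiction (sym eq) (cycle-distinct r-isRep b<a a<d)

  rep-≤-onCycle : ∀ {d d′ r r′} i j → IsCycleRep σ d r → IsCycleRep σ d′ r′ →
    σ ^[ i ] r ≡ σ ^[ j ] r′ → r Fin.≤ r′
  rep-≤-onCycle {r = r} i j r-isRep r′-isRep eq with cycle-closes r′-isRep j
  ... | k , back = subst (r Fin.≤_) (trans (^-+ k i r) (trans (cong (σ ^[ k ]_) eq) back))
                     (rep-minimal r-isRep (k + i))

  rep-unique : ∀ {d d′ r r′} i j → IsCycleRep σ d r → IsCycleRep σ d′ r′ →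
    σ ^[ i ] r ≡ σ ^[ j ] r′ → r ≡ r′
  rep-unique i j r-isRep r′-isRep eq =
    FinP.≤-antisym (rep-≤-onCycle i j r-isRep r′-isRep eq) (rep-≤-onCycle j i r′-isRep r-isRep (sym eq))

  length-unique : ∀ {d d′ r} → IsCycleRep σ d r → IsCycleRep σ d′ r → d ≡ d′
  length-unique {d} {d′} (1≤d , fix , noEarlier , _) (1≤d′ , fix′ , noEarlier′ , _) with ℕP.<-cmp d d′
  ... | tri< d<d′ _ _ = contradiction fix (noEarlier′ d 1≤d d<d′)
  ... | tri≈ _ d≡d′ _ = d≡d′
  ... | tri> _ _ d′<d = contradiction fix′ (noEarlier d′ 1≤d′ d′<d)

  -- σ^a r = σ^b r forces a ≡ b (mod d), and σ^d fixes x.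
  ^-transfer : ∀ {d r x} a b → IsCycleRep σ d r → σ ^[ d ] x ≡ x → σ ^[ a ] r ≡ σ ^[ b ] r → σ ^[ a ] x ≡ σ ^[ b ] x
  ^-transfer {suc d} {r} {x} a b r-isRep@(_ , fix , _) fixˣ eq = begin
    σ ^[ a ] x             ≡⟨ ^-%-fixed a fixˣ ⟩
    σ ^[ a % suc d ] x     ≡⟨ cong (λ k → σ ^[ k ] x) a%≡b% ⟩
    σ ^[ b % suc d ] x     ≡⟨ ^-%-fixed b fixˣ ⟨
    σ ^[ b ] x             ∎
    where
    open ≡-Reasoning
    a%≡b% : a % suc d ≡ b % suc d
    a%≡b% = ^-injective-below r-isRep (m%n<n a (suc d)) (m%n<n b (suc d))
              (trans (sym (^-%-fixed a fix)) (trans eq (^-%-fixed b fix)))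

  length-∣ : ∀ {d r e} → IsCycleRep σ d r → σ ^[ e ] r ≡ r → d ∣ e
  length-∣ {suc d} {r} {e} (_ , fix , noEarlier , _) σᵉr≡r with e % suc d in e%d
  ... | zero  = m%n≡0⇒n∣m e (suc d) e%d
  ... | suc k = contradiction (subst (λ j → σ ^[ j ] r ≡ r) e%d (trans (sym (^-%-fixed e fix)) σᵉr≡r))
                  (noEarlier (suc k) (s≤s z≤n) (subst (_< suc d) e%d (m%n<n e (suc d))))

  rep : Fin n → Fin n
  rep v = CycleOf.rep (cycleOf v)

  period : Fin n → ℕ
  period v = CycleOf.period (cycleOf v)

  offset : Fin n → ℕ
  offset v = CycleOf.offset (cycleOf v)

  rep-isRep : ∀ v → IsCycleRep σ (period v) (rep v)
  rep-isRep v = CycleOf.isRep (cycleOf v)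

  rep-reaches : ∀ v → σ ^[ offset v ] (rep v) ≡ v
  rep-reaches v = CycleOf.reaches (cycleOf v)

  period≤n : ∀ v → period v ≤ n
  period≤n v = CycleOf.period≤n (cycleOf v)

  1≤period : ∀ v → 1 ≤ period v
  1≤period v = proj₁ (rep-isRep v)

  rep-onCycle : ∀ {d r} j {v} → IsCycleRep σ d r → σ ^[ j ] r ≡ v → rep v ≡ r × period v ≡ d
  rep-onCycle j {v} r-isRep eq =
    rep≡r , length-unique (subst (IsCycleRep σ (period v)) rep≡r (rep-isRep v)) r-isRep
    where
    rep≡r = rep-unique (offset v) j (rep-isRep v) r-isRep (trans (rep-reaches v) (sym eq))

  rep-^ : ∀ k v → rep (σ ^[ k ] v) ≡ rep v × period (σ ^[ k ] v) ≡ period v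
  rep-^ k v = rep-onCycle (k + offset v) (rep-isRep v) (trans (^-+ k (offset v) (rep v)) (cong (σ ^[ k ]_) (rep-reaches v)))

  rep-of-rep : ∀ {d r} → IsCycleRep σ d r → rep r ≡ r × period r ≡ d
  rep-of-rep r-isRep = rep-onCycle 0 r-isRep refl

-- Walks in a graph

module Walks {n : ℕ} (E : Adj n) where

  open import Data.List.Membership.DecPropositional (_≟_ {n}) using (_∈?_)

  Edge : Fin n → Fin n → Set
  Edge i j = T (E i j)

  vertices : ∀ {u v} → Walk E u v → List (Fin n)
  vertices (here {u})     = u ∷ []
  vertices (step {u} _ w) = u ∷ vertices w

  departures : ∀ {u v} → Walk E u v → List (Fin n)
  departures here           = []
  departures (step {u} _ w) = u ∷ departures w

  Simple : ∀ {u v} → Walk E u v → Set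
  Simple w = Unique (vertices w)

  vertices≡departures∷ʳ : ∀ {u v} (w : Walk E u v) → vertices w ≡ departures w ++ [ v ]
  vertices≡departures∷ʳ here       = refl
  vertices≡departures∷ʳ (step _ w) = cong (_ ∷_) (vertices≡departures∷ʳ w)

  vertices-subst : ∀ {u v v′} (eq : v ≡ v′) (w : Walk E u v) → vertices (subst (Walk E u) eq w) ≡ vertices w
  vertices-subst refl w = refl

  start∈vertices : ∀ {u v} (w : Walk E u v) → u ∈ vertices w
  start∈vertices here       = here refl
  start∈vertices (step _ _) = here refl

  end∈vertices : ∀ {u v} (w : Walk E u v) → v ∈ vertices w
  end∈vertices here       = here refl
  end∈vertices (step _ w) = there (end∈vertices w)

  _++ʷ_ : ∀ {u v x} → Walk E u v → Walk E v x → Walk E u x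
  here       ++ʷ w₂ = w₂
  step e w₁ ++ʷ w₂ = step e (w₁ ++ʷ w₂)

  vertices-++ʷ : ∀ {u v x} (w₁ : Walk E u v) (w₂ : Walk E v x) → vertices (w₁ ++ʷ w₂) ≡ departures w₁ ++ vertices w₂
  vertices-++ʷ here        w₂ = refl
  vertices-++ʷ (step _ w₁) w₂ = cong (_ ∷_) (vertices-++ʷ w₁ w₂)

  departures-++ʷ : ∀ {u v x} (w₁ : Walk E u v) (w₂ : Walk E v x) → departures (w₁ ++ʷ w₂) ≡ departures w₁ ++ departures w₂
  departures-++ʷ here        w₂ = refl
  departures-++ʷ (step _ w₁) w₂ = cong (_ ∷_) (departures-++ʷ w₁ w₂)

  splitAt : ∀ {u v} (w : Walk E u v) {x} → x ∈ vertices w →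
    Σ (Walk E u x) λ w₁ → Σ (Walk E x v) λ w₂ → vertices w ≡ departures w₁ ++ vertices w₂
  splitAt here       (here refl) = here , here , refl
  splitAt (step e w) (here refl) = here , step e w , refl
  splitAt (step e w) (there x∈) with splitAt w x∈
  ... | w₁ , w₂ , eq = step e w₁ , w₂ , cong (_ ∷_) eq

  splitAtFirst : ∀ {u v} (w : Walk E u v) (L : List (Fin n)) → v ∈ L →
    Σ (Fin n) λ x → Σ (Walk E u x) λ w₁ → Σ (Walk E x v) λ w₂ →
      vertices w ≡ departures w₁ ++ vertices w₂ × x ∈ L × (∀ {y} → y ∈ departures w₁ → y ∉ L)
  splitAtFirst (here {u}) L u∈L = u , here , here , refl , u∈L , λ ()
  splitAtFirst (step {u} e w) L v∈L with u ∈? L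
  ... | yes u∈L = u , here , step e w , refl , u∈L , λ ()
  ... | no u∉L with splitAtFirst w L v∈L
  ...   | x , w₁ , w₂ , eq , x∈L , avoid =
          x , step e w₁ , w₂ , cong (u ∷_) eq , x∈L , λ { (here refl) → u∉L ; (there y∈) → avoid y∈ }

  loopErase : ∀ {u v} → Walk E u v → Σ (Walk E u v) Simple
  loopErase here = here , ([] ∷ [])
  loopErase (step {u} e w) with loopErase w
  ... | w′ , simple with u ∈? vertices w′
  ...   | no u∉  = step e w′ , All.tabulate (λ { x∈ refl → u∉ x∈ }) ∷ simple
  ...   | yes u∈ with splitAt w′ u∈
  ...     | w₁ , w₂ , eq = w₂ , Unique-++⁻ʳ (departures w₁) (subst Unique eq simple)

  vertices-linked : ∀ {u v} (w : Walk E u v) → Linked Edge (vertices w)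
  vertices-linked here                = [-]
  vertices-linked (step e here)       = e ∷ [-]
  vertices-linked (step e (step f w)) = e ∷ vertices-linked (step f w)

  linked-∷ : ∀ {R : Fin n → Fin n → Set} {x u v} (w : Walk E u v) → R x u → Linked R (vertices w) → Linked R (x ∷ vertices w)
  linked-∷ here       r _ = r ∷ [-]
  linked-∷ (step _ _) r l = r ∷ l

  closed⇒HasCycle : ∀ {a} (C : Walk E a a) → Unique (departures C) → 3 ≤ length (departures C) → HasCycle E
  closed⇒HasCycle {a} (step e w) unique (s≤s 2≤len) =
    a , departures w , 2≤len , unique , subst (Linked Edge) (vertices≡departures∷ʳ (step e w)) (vertices-linked (step e w))

  prefix-⊆ : ∀ {u x v} (w₁ : Walk E u x) (w₂ : Walk E x v) {y} → y ∈ vertices w₁ → y ∈ departures w₁ ++ vertices w₂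
  prefix-⊆ w₁ w₂ y∈ with ∈-++⁻ (departures w₁) (subst (_ ∈_) (vertices≡departures∷ʳ w₁) y∈)
  ... | inj₁ y∈d        = ∈-++⁺ˡ y∈d
  ... | inj₂ (here refl) = ∈-++⁺ʳ (departures w₁) (start∈vertices w₂)

  prefix-simple : ∀ {u x v} (w₁ : Walk E u x) (w₂ : Walk E x v) → Unique (departures w₁ ++ vertices w₂) → Simple w₁
  prefix-simple w₁ w₂ unique = subst Unique (sym (vertices≡departures∷ʳ w₁))
    (Unique.++⁺ (Unique-++⁻ˡ (departures w₁) unique) ([] ∷ [])
      λ { (y∈ , here refl) → Unique-++⇒∉ (departures w₁) unique y∈ (start∈vertices w₂) })

  next : ∀ {u v} → Walk E u v → Fin n
  next {u} w = second u (vertices w)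

  next-step : ∀ {u x v} (e : Edge u x) (w : Walk E x v) → next (step e w) ≡ x
  next-step e here       = refl
  next-step e (step _ _) = refl

  1≤length-vertices : ∀ {u v} (w : Walk E u v) → 1 ≤ length (vertices w)
  1≤length-vertices here       = s≤s z≤n
  1≤length-vertices (step _ _) = s≤s z≤n

  module Undirected (symmetric : ∀ i j → E i j ≡ E j i) where

    flip : ∀ {i j} → Edge i j → Edge j i
    flip {i} {j} = subst T (symmetric i j)

    reverse : ∀ {u v} → Walk E u v → Walk E v u
    reverse here       = here
    reverse (step e w) = reverse w ++ʷ step (flip e) here

    vertices-reverse : ∀ {u v} (w : Walk E u v) → vertices (reverse w) ≡ List.reverse (vertices w)
    vertices-reverse here = refl
    vertices-reverse (step {u} {x} e w) = begin
      vertices (reverse w ++ʷ step (flip e) here)  ≡⟨ vertices-++ʷ (reverse w) _ ⟩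
      departures (reverse w) ++ [ x ] ++ [ u ]     ≡⟨ ++-assoc (departures (reverse w)) [ x ] [ u ] ⟨
      (departures (reverse w) ++ [ x ]) ++ [ u ]   ≡⟨ cong (_++ [ u ]) (vertices≡departures∷ʳ (reverse w)) ⟨
      vertices (reverse w) ++ [ u ]                ≡⟨ cong (_++ [ u ]) (vertices-reverse w) ⟩
      List.reverse (vertices w) ++ [ u ]           ≡⟨ unfold-reverse u (vertices w) ⟨
      List.reverse (u ∷ vertices w)                ∎
      where open ≡-Reasoning

    ∈-reverse⁻ : ∀ {u v} (w : Walk E u v) {x} → x ∈ vertices (reverse w) → x ∈ vertices w
    ∈-reverse⁻ w x∈ = ∈-resp-↭ (↭-reverse (vertices w)) (subst (_ ∈_) (vertices-reverse w) x∈)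

    reverse-simple : ∀ {u v} (w : Walk E u v) → Simple w → Simple (reverse w)
    reverse-simple w simple =
      subst Unique (sym (vertices-reverse w)) (Unique-resp-↭ (↭-sym (↭-reverse (vertices w))) simple)

    length-reverse : ∀ {u v} (w : Walk E u v) → length (vertices (reverse w)) ≡ length (vertices w)
    length-reverse w = trans (cong length (vertices-reverse w)) (↭-length (↭-reverse (vertices w)))

    2≤length-fork : ∀ {u₁ u₂ x} (P : Walk E u₁ x) (Q : Walk E u₂ x) → u₁ ≢ u₂ →
      2 ≤ length (departures P ++ vertices (reverse Q))
    2≤length-fork (step _ P) Q _ = s≤s (subst (1 ≤_) (sym (length-++ (departures P)))
      (ℕP.≤-trans (1≤length-vertices (reverse Q)) (ℕP.m≤n+m _ (length (departures P)))))
    2≤length-fork here here       u≢u = contradiction refl u≢u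
    2≤length-fork here (step e Q) _   = subst (2 ≤_) (sym (length-reverse (step e Q))) (s≤s (1≤length-vertices Q))

    -- Follow r₁ until it first meets r₂, then return along r₂: with the edges at a this closes a cycle.
    fork⇒HasCycle : ∀ {a u₁ u₂ b} → Edge a u₁ → Edge a u₂ → u₁ ≢ u₂ →
      (r₁ : Walk E u₁ b) (r₂ : Walk E u₂ b) → Simple r₁ → Simple r₂ →
      a ∉ vertices r₁ → a ∉ vertices r₂ → HasCycle E
    fork⇒HasCycle {a} e₁ e₂ u₁≢u₂ r₁ r₂ simple₁ simple₂ a∉r₁ a∉r₂
      with splitAtFirst r₁ (vertices r₂) (end∈vertices r₂)
    ... | x , P , _ , eq₁ , x∈r₂ , P-avoids-r₂ with splitAt r₂ x∈r₂
    ...   | Q , Q′ , eq₂ = closed⇒HasCycle C (subst Unique (sym departures-C) unique)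
                             (subst (λ xs → 3 ≤ length xs) (sym departures-C) (s≤s (2≤length-fork P Q u₁≢u₂)))
      where
      C : Walk E a a
      C = step e₁ (P ++ʷ (reverse Q ++ʷ step (flip e₂) here))

      departures-C : departures C ≡ a ∷ departures P ++ vertices (reverse Q)
      departures-C = cong (a ∷_) (trans (departures-++ʷ P _) (cong (departures P ++_)
        (trans (departures-++ʷ (reverse Q) _) (sym (vertices≡departures∷ʳ (reverse Q))))))

      P⊆r₁ : ∀ {y} → y ∈ departures P → y ∈ vertices r₁
      P⊆r₁ y∈ = subst (_ ∈_) (sym eq₁) (∈-++⁺ˡ y∈)

      Q⊆r₂ : ∀ {y} → y ∈ vertices (reverse Q) → y ∈ vertices r₂
      Q⊆r₂ y∈ = subst (_ ∈_) (sym eq₂) (prefix-⊆ Q Q′ (∈-reverse⁻ Q y∈))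

      a∉ : ∀ {y} → y ∈ departures P ++ vertices (reverse Q) → a ≢ y
      a∉ y∈ refl with ∈-++⁻ (departures P) y∈
      ... | inj₁ y∈P = a∉r₁ (P⊆r₁ y∈P)
      ... | inj₂ y∈Q = a∉r₂ (Q⊆r₂ y∈Q)

      unique : Unique (a ∷ departures P ++ vertices (reverse Q))
      unique = All.tabulate a∉ ∷ Unique.++⁺ (Unique-++⁻ˡ (departures P) (subst Unique eq₁ simple₁))
        (reverse-simple Q (prefix-simple Q Q′ (subst Unique eq₂ simple₂)))
        (λ (y∈P , y∈Q) → P-avoids-r₂ y∈P (Q⊆r₂ y∈Q))

    simple-walk-unique : ¬ HasCycle E → ∀ {a b} (w₁ w₂ : Walk E a b) → Simple w₁ → Simple w₂ →
      vertices w₁ ≡ vertices w₂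
    simple-walk-unique acyclic here       here       _ _ = refl
    simple-walk-unique acyclic here       (step _ r) _ simple = contradiction (end∈vertices r) (Unique.Unique[x∷xs]⇒x∉xs simple)
    simple-walk-unique acyclic (step _ r) here       simple _ = contradiction (end∈vertices r) (Unique.Unique[x∷xs]⇒x∉xs simple)
    simple-walk-unique acyclic (step {_} {u₁} e₁ r₁) (step {_} {u₂} e₂ r₂) simple₁@(_ ∷ simple-r₁) simple₂@(_ ∷ simple-r₂)
      with u₁ ≟ u₂
    ... | yes refl = cong (_ ∷_) (simple-walk-unique acyclic r₁ r₂ simple-r₁ simple-r₂)
    ... | no u₁≢u₂ = contradiction (fork⇒HasCycle e₁ e₂ u₁≢u₂ r₁ r₂ simple-r₁ simple-r₂
                       (Unique.Unique[x∷xs]⇒x∉xs simple₁) (Unique.Unique[x∷xs]⇒x∉xs simple₂)) acyclic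

module _ {n : ℕ} {E E′ : Adj n} (f : Fin n → Fin n) (f-edge : ∀ {i j} → T (E i j) → T (E′ (f i) (f j))) where
  private
    module W = Walks E
    module W′ = Walks E′

  mapʷ : ∀ {u v} → Walk E u v → Walk E′ (f u) (f v)
  mapʷ here       = here
  mapʷ (step e w) = step (f-edge e) (mapʷ w)

  vertices-mapʷ : ∀ {u v} (w : Walk E u v) → W′.vertices (mapʷ w) ≡ List.map f (W.vertices w)
  vertices-mapʷ here       = refl
  vertices-mapʷ (step _ w) = cong (_ ∷_) (vertices-mapʷ w)

-- Rooted trees as parent functions

T-ext : ∀ {a b : Bool} → (T a → T b) → (T b → T a) → a ≡ b
T-ext {false} {false} _ _ = refl
T-ext {false} {true}  _ g = contradiction (g tt) λ ()
T-ext {true}  {false} f _ = contradiction (f tt) λ ()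
T-ext {true}  {true}  _ _ = refl

module RootedTrees {n : ℕ} (root : Fin n) where

  record ParentFunction : Set where
    field
      parent       : Fin n → Fin n
      parent-root  : parent root ≡ root
      depth        : Fin n → ℕ
      depth-parent : ∀ v → v ≢ root → depth (parent v) < depth v

  ChildOf : (Fin n → Fin n) → Fin n → Fin n → Set
  ChildOf parent i j = i ≢ root × parent i ≡ j

  ChildOf-cong : ∀ {p q : Fin n → Fin n} → (∀ v → p v ≡ q v) → ∀ {i j} → ChildOf p i j → ChildOf q i j
  ChildOf-cong p≗q (i≢root , eq) = i≢root , trans (sym (p≗q _)) eq

  module ParentTree (P : ParentFunction) where
    open ParentFunction P

    childOf? : ∀ i j → Dec (ChildOf parent i j)
    childOf? i j = ¬? (i ≟ root) ×-dec (parent i ≟ j)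

    adjacency : Adj n
    adjacency i j = ⌊ childOf? i j ⊎-dec childOf? j i ⌋

    adjacent⇒ : ∀ {i j} → T (adjacency i j) → ChildOf parent i j ⊎ ChildOf parent j i
    adjacent⇒ = toWitness

    adjacent⇐ : ∀ {i j} → ChildOf parent i j ⊎ ChildOf parent j i → T (adjacency i j)
    adjacent⇐ = fromWitness

    childOf-depth : ∀ {i j} → ChildOf parent i j → depth j < depth i
    childOf-depth (i≢root , refl) = depth-parent _ i≢root

    symmetric : ∀ i j → adjacency i j ≡ adjacency j i
    symmetric i j = T-ext (adjacent⇐ ∘ swap ∘ adjacent⇒) (adjacent⇐ ∘ swap ∘ adjacent⇒)

    irreflexive : ∀ i → ¬ T (adjacency i i)
    irreflexive i adj with adjacent⇒ adj
    ... | inj₁ c = ℕP.<-irrefl refl (childOf-depth c)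
    ... | inj₂ c = ℕP.<-irrefl refl (childOf-depth c)

    open Walks adjacency

    ancestors : ∀ v → Acc _<_ (depth v) → Walk adjacency v root
    ancestors v (acc below) with v ≟ root
    ... | yes refl  = here
    ... | no v≢root = step (adjacent⇐ (inj₁ (v≢root , refl))) (ancestors (parent v) (below (depth-parent v v≢root)))

    ancestors-descending : ∀ v a → Linked (λ x y → depth y < depth x) (vertices (ancestors v a))
    ancestors-descending v (acc below) with v ≟ root
    ... | yes refl = [-]
    ... | no v≢root = linked-∷ (ancestors (parent v) (below (depth-parent v v≢root))) (depth-parent v v≢root)
                         (ancestors-descending (parent v) (below (depth-parent v v≢root)))

    ancestors-next : ∀ v a → next (ancestors v a) ≡ parent v
    ancestors-next v (acc below) with v ≟ root
    ... | yes refl  = sym parent-root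
    ... | no v≢root = next-step (adjacent⇐ (inj₁ (v≢root , refl))) (ancestors (parent v) (below (depth-parent v v≢root)))

    pathToRoot : ∀ v → Walk adjacency v root
    pathToRoot v = ancestors v (<-wellFounded (depth v))

    pathToRoot-simple : ∀ v → Simple (pathToRoot v)
    pathToRoot-simple v = AllPairs.map (λ lt eq → ℕP.<-irrefl (cong depth (sym eq)) lt)
      (Linked⇒AllPairs (λ p q → ℕP.<-trans q p) (ancestors-descending v (<-wellFounded (depth v))))

    open Undirected symmetric

    connected : Connected adjacency
    connected u v = pathToRoot u ++ʷ reverse (pathToRoot v)

    NonBacktracking : List (Fin n) → Set
    NonBacktracking (a ∷ b ∷ c ∷ rest) = a ≢ c × NonBacktracking (b ∷ c ∷ rest)
    NonBacktracking _                  = ⊤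

    Down : Fin n → Fin n → Set
    Down a b = ChildOf parent b a

    EndsDown : List (Fin n) → Set
    EndsDown (a ∷ b ∷ [])       = Down a b
    EndsDown (_ ∷ b ∷ c ∷ rest) = EndsDown (b ∷ c ∷ rest)
    EndsDown _                  = ⊥

    lastOr : Fin n → List (Fin n) → Fin n
    lastOr d []       = d
    lastOr _ (x ∷ xs) = lastOr x xs

    -- After a step down, stepping up again would return to the vertex just left.
    descends : ∀ {a b} rest → Linked Edge (a ∷ b ∷ rest) → NonBacktracking (a ∷ b ∷ rest) → Down a b →
      EndsDown (a ∷ b ∷ rest) × depth a < depth (lastOr b rest)
    descends []         _       _          down = down , childOf-depth down
    descends (c ∷ rest) (_ ∷ l) (a≢c , nb) down with adjacent⇒ (Linked.head l)
    ... | inj₁ (_ , parent-b≡c) = contradiction (trans (sym (proj₂ down)) parent-b≡c) a≢c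
    ... | inj₂ down′ with descends rest l nb down′
    ...   | ends , deeper = ends , ℕP.<-trans (childOf-depth down) deeper

    climbs-or-ends-down : ∀ {a b} rest → Linked Edge (a ∷ b ∷ rest) → NonBacktracking (a ∷ b ∷ rest) →
      depth (lastOr b rest) < depth a ⊎ EndsDown (a ∷ b ∷ rest)
    climbs-or-ends-down [] (adj ∷ _) _ with adjacent⇒ adj
    ... | inj₁ up   = inj₁ (childOf-depth up)
    ... | inj₂ down = inj₂ down
    climbs-or-ends-down (c ∷ rest) l@(adj ∷ l′) nb@(_ , nb′) with adjacent⇒ adj
    ... | inj₂ down = inj₂ (proj₁ (descends (c ∷ rest) l nb down))
    ... | inj₁ up with climbs-or-ends-down rest l′ nb′
    ...   | inj₁ higher = inj₁ (ℕP.<-trans higher (childOf-depth up))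
    ...   | inj₂ ends   = inj₂ ends

    lastOr-∷ʳ : ∀ d ys x → lastOr d (ys ++ [ x ]) ≡ x
    lastOr-∷ʳ d []       x = refl
    lastOr-∷ʳ d (y ∷ ys) x = lastOr-∷ʳ y ys x

    lastOr-∈ : ∀ d ys → lastOr d ys ∈ d ∷ ys
    lastOr-∈ d []       = here refl
    lastOr-∈ d (y ∷ ys) = there (lastOr-∈ y ys)

    EndsDown-∷ʳ : ∀ y ys x → EndsDown (y ∷ ys ++ [ x ]) → Down (lastOr y ys) x
    EndsDown-∷ʳ y []             x ends = ends
    EndsDown-∷ʳ y (y′ ∷ [])      x ends = ends
    EndsDown-∷ʳ y (y′ ∷ y″ ∷ ys) x ends = EndsDown-∷ʳ y′ (y″ ∷ ys) x ends

    unique⇒nonBacktracking : ∀ vs x → Unique vs → x ∉ vs → NonBacktracking (vs ++ [ x ])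
    unique⇒nonBacktracking []              x _              _   = tt
    unique⇒nonBacktracking (a ∷ [])        x _              _   = tt
    unique⇒nonBacktracking (a ∷ b ∷ [])    x _              x∉ = (λ { refl → x∉ (here refl) }) , tt
    unique⇒nonBacktracking (a ∷ b ∷ c ∷ r) x (a∉ ∷ unique) x∉ =
      All.lookup a∉ (there (here refl)) , unique⇒nonBacktracking (b ∷ c ∷ r) x unique (x∉ ∘ there)

    -- A closed walk can neither only descend nor only climb, so it leaves and re-enters x through parent x.
    closed-walk-backtracks : ∀ x v₁ v₂ vs → Linked Edge (x ∷ v₁ ∷ (v₂ ∷ vs) ++ [ x ]) →
      NonBacktracking (x ∷ v₁ ∷ (v₂ ∷ vs) ++ [ x ]) → v₁ ∉ v₂ ∷ vs → ⊥
    closed-walk-backtracks x v₁ v₂ vs linked nb v₁∉ with adjacent⇒ (Linked.head linked)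
    ... | inj₂ down = ℕP.<-irrefl (cong depth (sym last≡x)) (proj₂ (descends _ linked nb down))
      where last≡x = lastOr-∷ʳ v₁ (v₂ ∷ vs) x
    ... | inj₁ up with climbs-or-ends-down _ linked nb
    ...   | inj₁ higher = ℕP.<-irrefl (cong depth (lastOr-∷ʳ v₁ (v₂ ∷ vs) x)) higher
    ...   | inj₂ ends   = v₁∉ (subst (_∈ v₂ ∷ vs) (trans (sym (proj₂ (EndsDown-∷ʳ v₁ (v₂ ∷ vs) x ends))) (proj₂ up))
                                 (lastOr-∈ v₂ vs))

    acyclic : ¬ HasCycle adjacency
    acyclic (x , []          , ()      , _)
    acyclic (x , _ ∷ []      , s≤s () , _)
    acyclic (x , v₁ ∷ v₂ ∷ vs , _ , x∉ ∷ unique@(v₁∉ ∷ _) , linked) =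
      closed-walk-backtracks x v₁ v₂ vs linked
        (All.lookup x∉ (there (here refl)) , unique⇒nonBacktracking (v₁ ∷ v₂ ∷ vs) x unique (λ x∈ → All.lookup x∉ x∈ refl))
        (λ v₁∈ → All.lookup v₁∉ v₁∈ refl)

    isSpanningTree : IsSpanningTree adjacency
    isSpanningTree = record
      { symmetric = symmetric ; irreflexive = irreflexive ; connected = connected ; acyclic = acyclic }

  module TreeParent {E : Adj n} (tree : IsSpanningTree E) where
    open IsSpanningTree tree
    open Walks E
    open Undirected symmetric
    open import Data.List.Membership.DecPropositional (_≟_ {n}) using (_∈?_)

    path : ∀ v → Walk E v root
    path v = proj₁ (loopErase (connected v root))

    path-simple : ∀ v → Simple (path v)
    path-simple v = proj₂ (loopErase (connected v root))

    path-unique : ∀ {v} (w : Walk E v root) → Simple w → vertices w ≡ vertices (path v)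
    path-unique w simple = simple-walk-unique acyclic w (path _) simple (path-simple _)

    parent : Fin n → Fin n
    parent v = next (path v)

    depth : Fin n → ℕ
    depth v = length (vertices (path v))

    depth-next : ∀ {v} (w : Walk E v root) → Simple w → v ≢ root → depth (next w) < length (vertices w)
    depth-next here                _               v≢root = contradiction refl v≢root
    depth-next (step e w) (_ ∷ simple) _ rewrite next-step e w =
      s≤s (ℕP.≤-reflexive (cong length (sym (path-unique w simple))))

    parentFunction : ParentFunction
    parentFunction = record
      { parent       = parent
      ; parent-root  = cong (second root) (sym (path-unique here ([] ∷ [])))
      ; depth        = depth
      ; depth-parent = λ v → depth-next (path v) (path-simple v)
      }

    edge-next : ∀ {v} (w : Walk E v root) → v ≢ root → Edge v (next w)
    edge-next here       v≢root = contradiction refl v≢root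
    edge-next (step e w) _      rewrite next-step e w = e

    parent-via : ∀ {i j} → Edge i j → i ∉ vertices (path j) → ChildOf parent i j
    parent-via {i} {j} e i∉ = (λ { refl → i∉ (end∈vertices (path j)) }) ,
      trans (cong (second i) (sym (path-unique (step e (path j)) simple))) (next-step e (path j))
      where
      simple : Simple (step e (path j))
      simple = All.tabulate (λ { x∈ refl → i∉ x∈ }) ∷ path-simple j

    edge⇒childOf : ∀ {i j} → Edge i j → ChildOf parent i j ⊎ ChildOf parent j i
    edge⇒childOf {i} {j} e with i ∈? vertices (path j) | j ∈? vertices (path i)
    ... | no i∉  | _      = inj₁ (parent-via e i∉)
    ... | yes _  | no j∉  = inj₂ (parent-via (flip e) j∉)
    -- Otherwise path i is the tail of path j after i, so j would occur twice on path j.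
    ... | yes i∈ | yes j∈ with splitAt (path j) i∈
    ...   | Q , Q′ , eq = contradiction (subst (j ∈_) (sym (path-unique Q′ (Unique-++⁻ʳ (departures Q) unique))) j∈)
                                        (j∉ Q unique)
      where
      unique = subst Unique eq (path-simple j)
      j∉ : (Q : Walk E j i) → Unique (departures Q ++ vertices Q′) → j ∉ vertices Q′
      j∉ here       _      j∈Q′ = irreflexive j e
      j∉ (step f Q) unique j∈Q′ = Unique-++⇒∉ (departures (step f Q)) unique (here refl) j∈Q′

  open ParentFunction using (parent)

  adjacency-treeParent : ∀ {E} (tree : IsSpanningTree E) i j →
    ParentTree.adjacency (TreeParent.parentFunction tree) i j ≡ E i j
  adjacency-treeParent {E} tree i j = T-ext to (PT.adjacent⇐ ∘ edge⇒childOf)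
    where
    open TreeParent tree
    open IsSpanningTree tree using (symmetric)
    open Walks.Undirected E symmetric using (flip)
    module PT = ParentTree parentFunction
    to : T (PT.adjacency i j) → T (E i j)
    to adj with PT.adjacent⇒ adj
    ... | inj₁ (i≢root , refl) = edge-next (path i) i≢root
    ... | inj₂ (j≢root , refl) = flip (edge-next (path j) j≢root)

  parent-treeParent : ∀ P v → parent (TreeParent.parentFunction (ParentTree.isSpanningTree P)) v ≡ parent P v
  parent-treeParent P v = trans (cong (second v) (sym (TP.path-unique (PT.pathToRoot v) (PT.pathToRoot-simple v))))
                                (PT.ancestors-next v (<-wellFounded _))
    where
    module PT = ParentTree P
    module TP = TreeParent PT.isSpanningTree

  adjacency-cong : ∀ {P Q} → (∀ v → parent P v ≡ parent Q v) → ∀ i j →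
    ParentTree.adjacency P i j ≡ ParentTree.adjacency Q i j
  adjacency-cong {P} {Q} P≗Q i j =
    T-ext (Q.adjacent⇐ ∘ Sum.map (ChildOf-cong P≗Q) (ChildOf-cong P≗Q) ∘ P.adjacent⇒)
          (P.adjacent⇐ ∘ Sum.map (ChildOf-cong (sym ∘ P≗Q)) (ChildOf-cong (sym ∘ P≗Q)) ∘ Q.adjacent⇒)
    where
    module P = ParentTree P
    module Q = ParentTree Q

  parent-cong : ∀ {E E′} (tree : IsSpanningTree E) (tree′ : IsSpanningTree E′) → (∀ i j → E i j ≡ E′ i j) →
    ∀ v → parent (TreeParent.parentFunction tree) v ≡ parent (TreeParent.parentFunction tree′) v
  parent-cong {E} {E′} tree tree′ E≗E′ v = cong (second v) (begin
    vertices (T.path v)               ≡⟨ map-id (vertices (T.path v)) ⟨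
    List.map id (vertices (T.path v)) ≡⟨ vertices-mapʷ id cast (T.path v) ⟨
    vertices′ (mapʷ id cast (T.path v)) ≡⟨ T′.path-unique (mapʷ id cast (T.path v)) simple ⟩
    vertices′ (T′.path v)             ∎)
    where
    open ≡-Reasoning
    module T = TreeParent tree
    module T′ = TreeParent tree′
    open Walks E using (vertices)
    open Walks E′ using () renaming (vertices to vertices′)
    cast : ∀ {i j} → T (E i j) → T (E′ i j)
    cast {i} {j} = subst T (E≗E′ i j)
    simple : Unique (vertices′ (mapʷ id cast (T.path v)))
    simple = subst Unique (sym (trans (vertices-mapʷ id cast (T.path v)) (map-id _))) (T.path-simple v)

module InvariantTrees {m : ℕ} (σ : Permutation′ (suc m)) (σ-root : σ ⟨$⟩ʳ Fin.zero ≡ Fin.zero) where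
  open RootedTrees (Fin.zero {m})
  open Orbits σ using (σ-injective)

  record EquivariantParent : Set where
    field
      parentFunction : ParentFunction
    open ParentFunction parentFunction public
    field
      parent-σ : ∀ v → parent (σ ⟨$⟩ʳ v) ≡ σ ⟨$⟩ʳ parent v
      depth-σ  : ∀ v → depth (σ ⟨$⟩ʳ v) ≡ depth v

  ParentSetoid : Setoid _ _
  ParentSetoid = record
    { Carrier       = EquivariantParent
    ; _≈_           = λ P Q → ∀ v → EquivariantParent.parent P v ≡ EquivariantParent.parent Q v
    ; isEquivalence = record
      { refl  = λ v → refl
      ; sym   = λ P≈Q v → sym (P≈Q v)
      ; trans = λ P≈Q Q≈R v → trans (P≈Q v) (Q≈R v) } }

  σ≢root : ∀ {v} → v ≢ Fin.zero → σ ⟨$⟩ʳ v ≢ Fin.zero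
  σ≢root v≢root eq = v≢root (σ-injective (trans eq (sym σ-root)))

  toTree : EquivariantParent → InvariantTree σ
  toTree P = record { edges = adjacency ; isTree = isSpanningTree ; invariant = invariant }
    where
    open EquivariantParent P
    open ParentTree parentFunction
    σ-childOf : ∀ {i j} → ChildOf parent i j → ChildOf parent (σ ⟨$⟩ʳ i) (σ ⟨$⟩ʳ j)
    σ-childOf (i≢root , refl) = σ≢root i≢root , parent-σ _
    invariant : Invariant σ adjacency
    invariant i j = adjacent⇐ ∘ Sum.map σ-childOf σ-childOf ∘ adjacent⇒

  fromTree : InvariantTree σ → EquivariantParent
  fromTree T = record { parentFunction = parentFunction ; parent-σ = parent-σ ; depth-σ = depth-σ }
    where
    open InvariantTree T
    open TreeParent isTree
    open Walks edges using (vertices; vertices-subst)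
    σ-path : ∀ v → Walk edges (σ ⟨$⟩ʳ v) Fin.zero
    σ-path v = subst (Walk edges (σ ⟨$⟩ʳ v)) σ-root (mapʷ (σ ⟨$⟩ʳ_) (invariant _ _) (path v))
    σ-path-vertices : ∀ v → vertices (σ-path v) ≡ List.map (σ ⟨$⟩ʳ_) (vertices (path v))
    σ-path-vertices v = trans (vertices-subst σ-root _) (vertices-mapʷ (σ ⟨$⟩ʳ_) (invariant _ _) (path v))
    path-σ : ∀ v → vertices (path (σ ⟨$⟩ʳ v)) ≡ List.map (σ ⟨$⟩ʳ_) (vertices (path v))
    path-σ v = trans (sym (path-unique (σ-path v) (subst Unique (sym (σ-path-vertices v)) (Unique.map⁺ σ-injective (path-simple v)))))
                     (σ-path-vertices v)
    parent-σ : ∀ v → parent (σ ⟨$⟩ʳ v) ≡ σ ⟨$⟩ʳ parent v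
    parent-σ v = trans (cong (second (σ ⟨$⟩ʳ v)) (path-σ v)) (second-map (σ ⟨$⟩ʳ_) v (vertices (path v)))
    depth-σ : ∀ v → depth (σ ⟨$⟩ʳ v) ≡ depth v
    depth-σ v = trans (cong length (path-σ v)) (length-map (σ ⟨$⟩ʳ_) (vertices (path v)))

  open EquivariantParent using (parentFunction)
  open InvariantTree using (edges; isTree)

  toTree-cong : ∀ {P Q} → (∀ v → EquivariantParent.parent P v ≡ EquivariantParent.parent Q v) →
    ∀ i j → edges (toTree P) i j ≡ edges (toTree Q) i j
  toTree-cong {P} {Q} = adjacency-cong {parentFunction P} {parentFunction Q}

  fromTree-cong : ∀ {T T′} → (∀ i j → edges T i j ≡ edges T′ i j) →
    ∀ v → EquivariantParent.parent (fromTree T) v ≡ EquivariantParent.parent (fromTree T′) v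
  fromTree-cong {T} {T′} = parent-cong (isTree T) (isTree T′)

  toTree-fromTree : ∀ T i j → edges (toTree (fromTree T)) i j ≡ edges T i j
  toTree-fromTree T = adjacency-treeParent (isTree T)

  fromTree-toTree : ∀ P v → EquivariantParent.parent (fromTree (toTree P)) v ≡ EquivariantParent.parent P v
  fromTree-toTree P = parent-treeParent (parentFunction P)

  parents↔trees : Inverse ParentSetoid (TreeSetoid σ)
  parents↔trees = record
    { to        = toTree
    ; from      = fromTree
    ; to-cong   = λ {P} {Q} → toTree-cong {P} {Q}
    ; from-cong = λ {T} {T′} → fromTree-cong {T} {T′}
    ; inverse   = (λ {T} {P} P≈fromT i j → trans (toTree-cong {P} {fromTree T} P≈fromT i j) (toTree-fromTree T i j))
                , (λ {P} {T} T≈toP v → trans (fromTree-cong {T} {toTree P} T≈toP v) (fromTree-toTree P v))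
    }

-- Prüfer codes of ranked forests

last∈toList : ∀ {A : Set} {l} (s : Vec A (suc l)) → Vec.last s ∈ toList s
last∈toList (x ∷ [])     = here refl
last∈toList (x ∷ y ∷ s) = there (last∈toList (y ∷ s))

last-∷ : ∀ {A : Set} {l} (x : A) (s : Vec A (suc l)) → Vec.last (x ∷ s) ≡ Vec.last s
last-∷ x (_ ∷ _) = refl

-- Prüfer code of a forest on a node list K: node r has the value q r, which refers to the node c (q r)
-- if that lies in K and makes r a root otherwise. Encoding repeatedly deletes the first leaf of K (a node
-- no value refers to) and records its value; ⋆ is a junk entry, never emitted for a ranked forest.
module PruferCode {A : Set} (_≟_ : DecidableEquality A) (⋆ : A) (c : A → A) where
  open import Data.List.Membership.DecPropositional _≟_ using (_∈?_)

  Unused : List A → A → Set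
  Unused ts r = r ∉ map c ts

  unused? : ∀ ts → Decidable (Unused ts)
  unused? ts r = ¬? (r ∈? map c ts)

  Unused-⊆ : ∀ {ts ts′ r} → (∀ {t} → t ∈ ts → t ∈ ts′) → Unused ts′ r → Unused ts r
  Unused-⊆ ts⊆ts′ unused r∈ with ∈-map⁻ c r∈
  ... | t , t∈ , refl = unused (∈-map⁺ c (ts⊆ts′ t∈))

  Unused-cong : ∀ {ts ts′} K → (∀ {t} → t ∈ ts → t ∈ ts′) → (∀ {t} → t ∈ ts′ → t ∈ ts) →
    firstSplit (unused? ts) K ≡ firstSplit (unused? ts′) K
  Unused-cong {ts} {ts′} K ts⊆ts′ ts′⊆ts =
    firstSplit-cong (unused? ts) (unused? ts′) K (λ _ → Unused-⊆ ts′⊆ts) (λ _ → Unused-⊆ ts⊆ts′)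

  decode : (l : ℕ) → List A → Vec A l → A → A
  decode zero    K []      v = v
  decode (suc l) K (x ∷ s) v with firstSplit (unused? (x ∷ toList s)) K
  ... | nothing = decode l K s v
  ... | just (pre , ℓ , post) with v ≟ ℓ
  ...   | yes _ = x
  ...   | no _  = decode l (pre ++ post) s v

  -- Nodes removed earlier get larger ranks.
  rank : (l : ℕ) → List A → Vec A l → A → ℕ
  rank zero    K []      v = 0
  rank (suc l) K (x ∷ s) v with firstSplit (unused? (x ∷ toList s)) K
  ... | nothing = rank l K s v
  ... | just (pre , ℓ , post) with v ≟ ℓ
  ...   | yes _ = suc l
  ...   | no _  = rank l (pre ++ post) s v

  encode : (l : ℕ) → List A → (A → A) → Vec A l
  encode zero    K q = []
  encode (suc l) K q with firstSplit (unused? (map q K)) K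
  ... | nothing                = ⋆ ∷ encode l K q
  ... | just (pre , ℓ , post) = q ℓ ∷ encode l (pre ++ post) q

  private
    module Step {l} (K : List A) {x} {s : Vec A l} {pre ℓ post}
                (split : firstSplit (unused? (x ∷ toList s)) K ≡ just (pre , ℓ , post)) where

      decode-ℓ : decode (suc l) K (x ∷ s) ℓ ≡ x
      decode-ℓ rewrite split with ℓ ≟ ℓ
      ... | yes _   = refl
      ... | no ℓ≢ℓ = contradiction refl ℓ≢ℓ

      decode-≢ℓ : ∀ {r} → r ≢ ℓ → decode (suc l) K (x ∷ s) r ≡ decode l (pre ++ post) s r
      decode-≢ℓ {r} r≢ℓ rewrite split with r ≟ ℓ
      ... | yes r≡ℓ = contradiction r≡ℓ r≢ℓ
      ... | no _    = refl

      rank-ℓ : rank (suc l) K (x ∷ s) ℓ ≡ suc l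
      rank-ℓ rewrite split with ℓ ≟ ℓ
      ... | yes _   = refl
      ... | no ℓ≢ℓ = contradiction refl ℓ≢ℓ

      rank-≢ℓ : ∀ {r} → r ≢ ℓ → rank (suc l) K (x ∷ s) r ≡ rank l (pre ++ post) s r
      rank-≢ℓ {r} r≢ℓ rewrite split with r ≟ ℓ
      ... | yes r≡ℓ = contradiction r≡ℓ r≢ℓ
      ... | no _    = refl

  encode-split : ∀ {l K q pre ℓ post} → firstSplit (unused? (map q K)) K ≡ just (pre , ℓ , post) →
    encode (suc l) K q ≡ q ℓ ∷ encode l (pre ++ post) q
  encode-split split rewrite split = refl

  LastOutside : List A → ∀ {l} → Vec A l → Set
  LastOutside K {zero}  s = ⊤
  LastOutside K {suc l} s = c (Vec.last s) ∉ K

  record ValidCode (l : ℕ) (K : List A) (s : Vec A l) : Set where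
    field
      unique       : Unique K
      length≡      : length K ≡ l
      last-outside : LastOutside K s

  -- Otherwise c (last s) ∷ K, of length l + 2, would fit inside the l + 1 values c (x ∷ s).
  decode-splits : ∀ {l K x} {s : Vec A l} → ValidCode (suc l) K (x ∷ s) →
    firstSplit (unused? (x ∷ toList s)) K ≢ nothing
  decode-splits {l} {K} {x} {s} valid none = ℕP.<-irrefl refl (begin-strict
    suc l                         ≡⟨ length≡ ⟨
    length K                      <⟨ Unique⇒length≤ (All.tabulate (λ { r∈ refl → last-outside r∈ }) ∷ unique) y∷K⊆ ⟩
    length (map c (x ∷ toList s)) ≡⟨ trans (length-map c (x ∷ toList s)) (length-toList (x ∷ s)) ⟩
    suc l                         ∎)
    where
    open ValidCode valid
    open ℕP.≤-Reasoning
    y∷K⊆ : ∀ {r} → r ∈ c (Vec.last (x ∷ s)) ∷ K → r ∈ map c (x ∷ toList s)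
    y∷K⊆ (here refl) = ∈-map⁺ c (last∈toList (x ∷ s))
    y∷K⊆ (there r∈)  = decidable-stable (_ ∈? _) (firstSplit-nothing (unused? (x ∷ toList s)) K none r∈)

  record DecodeStep (l : ℕ) (K : List A) (x : A) (s : Vec A l) : Set where
    field
      pre post    : List A
      ℓ           : A
      split       : firstSplit (unused? (x ∷ toList s)) K ≡ just (pre , ℓ , post)
      K≡          : K ≡ pre ++ ℓ ∷ post
      unused      : Unused (x ∷ toList s) ℓ
      valid       : ValidCode l (pre ++ post) s
      decode-ℓ    : decode (suc l) K (x ∷ s) ℓ ≡ x
      decode-rest : ∀ {r} → r ∈ pre ++ post → decode (suc l) K (x ∷ s) r ≡ decode l (pre ++ post) s r
      rank-ℓ      : rank (suc l) K (x ∷ s) ℓ ≡ suc l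
      rank-rest   : ∀ {r} → r ∈ pre ++ post → rank (suc l) K (x ∷ s) r ≡ rank l (pre ++ post) s r

  decodeStep : ∀ {l K x} {s : Vec A l} → ValidCode (suc l) K (x ∷ s) → DecodeStep l K x s
  decodeStep {l} {K} {x} {s} valid with firstSplit (unused? (x ∷ toList s)) K in split
  ... | nothing = contradiction split (decode-splits valid)
  ... | just (pre , ℓ , post) with firstSplit-just (unused? (x ∷ toList s)) K split
  ...   | refl , unused = record
    { split = split ; K≡ = refl ; unused = unused
    ; valid = record
      { unique       = Unique-middle⁻ pre unique
      ; length≡      = ℕP.suc-injective (trans (sym (length-middle pre)) length≡)
      ; last-outside = last-outside′ s last-outside }
    ; decode-ℓ    = Step.decode-ℓ K split
    ; decode-rest = Step.decode-≢ℓ K split ∘ ∈-middle⇒≢ pre unique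
    ; rank-ℓ      = Step.rank-ℓ K split
    ; rank-rest   = Step.rank-≢ℓ K split ∘ ∈-middle⇒≢ pre unique }
    where
    open ValidCode valid
    last-outside′ : ∀ {l} (s : Vec A l) → LastOutside (pre ++ ℓ ∷ post) (x ∷ s) → LastOutside (pre ++ post) s
    last-outside′ []      _   = tt
    last-outside′ (y ∷ s) out = λ c∈ → out (subst (λ t → c t ∈ _) (sym (last-∷ x (y ∷ s))) (∈-middle⁺ pre c∈))

  decode-∈ : ∀ {l K r} {s : Vec A l} → ValidCode l K s → r ∈ K → decode l K s r ∈ toList s
  decode-∈ {zero} {_ ∷ _} valid _ with () ← ValidCode.length≡ valid
  decode-∈ {suc l} {s = x ∷ s} valid r∈ with decodeStep valid
  ... | record { pre = pre ; K≡ = refl ; valid = valid′ ; decode-ℓ = decode-ℓ ; decode-rest = decode-rest }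
    with ∈-middle⁻ pre r∈
  ...   | inj₁ refl = subst (_∈ toList (x ∷ s)) (sym decode-ℓ) (here refl)
  ...   | inj₂ r∈′  = subst (_∈ toList (x ∷ s)) (sym (decode-rest r∈′)) (there (decode-∈ valid′ r∈′))

  ∈-decode : ∀ {l K t} {s : Vec A l} → ValidCode l K s → t ∈ toList s → ∃ λ r → r ∈ K × decode l K s r ≡ t
  ∈-decode {suc l} {s = x ∷ s} valid t∈ with decodeStep valid
  ... | record { pre = pre ; ℓ = ℓ ; K≡ = refl ; valid = valid′ ; decode-ℓ = decode-ℓ ; decode-rest = decode-rest }
    with t∈
  ...   | here refl = ℓ , ∈-++⁺ʳ pre (here refl) , decode-ℓ
  ...   | there t∈s with ∈-decode valid′ t∈s
  ...     | r , r∈ , refl = r , ∈-middle⁺ pre r∈ , decode-rest r∈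

  rank≤ : ∀ {l K r} {s : Vec A l} → ValidCode l K s → r ∈ K → rank l K s r ≤ l
  rank≤ {zero} {_ ∷ _} valid _ with () ← ValidCode.length≡ valid
  rank≤ {suc l} {s = x ∷ s} valid r∈ with decodeStep valid
  ... | record { pre = pre ; K≡ = refl ; valid = valid′ ; rank-ℓ = rank-ℓ ; rank-rest = rank-rest }
    with ∈-middle⁻ pre r∈
  ...   | inj₁ refl = ℕP.≤-reflexive rank-ℓ
  ...   | inj₂ r∈′  = subst (_≤ suc l) (sym (rank-rest r∈′)) (ℕP.m≤n⇒m≤1+n (rank≤ valid′ r∈′))

  Unused⇒≢ : ∀ {ts ℓ t} → Unused ts ℓ → t ∈ ts → c t ≢ ℓ
  Unused⇒≢ unused t∈ refl = unused (∈-map⁺ c t∈)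

  -- r is removed while the node its value refers to is still present.
  rank-descends : ∀ {l K r} {s : Vec A l} → ValidCode l K s → r ∈ K → c (decode l K s r) ∈ K →
    rank l K s (c (decode l K s r)) < rank l K s r
  rank-descends {zero} {_ ∷ _} valid _ with () ← ValidCode.length≡ valid
  rank-descends {suc l} {s = x ∷ s} valid r∈ cq∈ with decodeStep valid
  ... | record { pre = pre ; post = post ; unused = unused ; K≡ = refl ; valid = valid′
               ; decode-rest = decode-rest ; rank-ℓ = rank-ℓ ; rank-rest = rank-rest }
    with ∈-middle⁻ pre cq∈
  ...   | inj₁ cq≡ℓ = contradiction cq≡ℓ (Unused⇒≢ unused (decode-∈ valid r∈))
  ...   | inj₂ cq∈′ with ∈-middle⁻ pre r∈
  ...     | inj₁ refl = subst₂ _<_ (sym (rank-rest cq∈′)) (sym rank-ℓ) (s≤s (rank≤ valid′ cq∈′))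
  ...     | inj₂ r∈′  = subst₂ _<_ (trans (cong (rank l (pre ++ post) s ∘ c) (sym (decode-rest r∈′))) (sym (rank-rest cq∈′)))
                                   (sym (rank-rest r∈′))
                          (rank-descends valid′ r∈′ (subst (λ t → c t ∈ pre ++ post) (decode-rest r∈′) cq∈′))

  RankedForest : List A → (A → A) → (A → ℕ) → Set
  RankedForest K q ρ = ∀ {r} → r ∈ K → c (q r) ∈ K → ρ (c (q r)) < ρ r

  record ValidForest (l : ℕ) (K : List A) (q : A → A) (ρ : A → ℕ) : Set where
    field
      unique  : Unique K
      length≡ : length K ≡ l
      ranked  : RankedForest K q ρ

  -- A node of maximal rank is a leaf.
  encode-splits : ∀ {l K q ρ} → ValidForest (suc l) K q ρ → firstSplit (unused? (map q K)) K ≢ nothing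
  encode-splits {K = []} valid _ with () ← ValidForest.length≡ valid
  encode-splits {K = k ∷ K} {q} {ρ} valid none =
    firstSplit-nothing (unused? (map q (k ∷ K))) (k ∷ K) none top∈ top-unused
    where
    top = argmax ρ k K
    top∈ : top ∈ k ∷ K
    top∈ with argmax-sel ρ k K
    ... | inj₁ top≡k = here top≡k
    ... | inj₂ top∈K = there top∈K
    maximal : ∀ {r} → r ∈ k ∷ K → ρ r ≤ ρ top
    maximal (here refl) = f[⊥]≤f[argmax] {f = ρ} k K
    maximal (there r∈)  = All.lookup (f[xs]≤f[argmax] {f = ρ} k K) r∈
    top-unused : Unused (map q (k ∷ K)) top
    top-unused t∈ with ∈-map⁻ c t∈
    ... | t , t∈′ , top≡ct with ∈-map⁻ q t∈′
    ...   | r , r∈ , refl = ℕP.<-irrefl refl (ℕP.<-≤-trans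
            (subst (λ t → ρ t < ρ r) (sym top≡ct) (ValidForest.ranked valid r∈ (subst (_∈ k ∷ K) top≡ct top∈)))
            (maximal r∈))

  record EncodeStep (l : ℕ) (K : List A) (q : A → A) (ρ : A → ℕ) : Set where
    field
      pre post : List A
      ℓ        : A
      split    : firstSplit (unused? (map q K)) K ≡ just (pre , ℓ , post)
      K≡       : K ≡ pre ++ ℓ ∷ post
      unused   : Unused (map q K) ℓ
      valid    : ValidForest l (pre ++ post) q ρ
      encode≡  : encode (suc l) K q ≡ q ℓ ∷ encode l (pre ++ post) q

  encodeStep : ∀ {l K q ρ} → ValidForest (suc l) K q ρ → EncodeStep l K q ρ
  encodeStep {l} {K} {q} valid with firstSplit (unused? (map q K)) K in split
  ... | nothing = contradiction split (encode-splits valid)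
  ... | just (pre , ℓ , post) with firstSplit-just (unused? (map q K)) K split
  ...   | refl , unused = record
    { split = split ; K≡ = refl ; unused = unused
    ; valid = record
      { unique  = Unique-middle⁻ pre unique
      ; length≡ = ℕP.suc-injective (trans (sym (length-middle pre)) length≡)
      ; ranked  = λ r∈ cq∈ → ranked (∈-middle⁺ pre r∈) (∈-middle⁺ pre cq∈) }
    ; encode≡ = encode-split split }
    where open ValidForest valid

  encode-⊆ : ∀ {l K q ρ t} → ValidForest l K q ρ → t ∈ toList (encode l K q) → ∃ λ r → r ∈ K × q r ≡ t
  encode-⊆ {suc l} valid t∈ with encodeStep valid
  ... | record { pre = pre ; ℓ = ℓ ; K≡ = refl ; valid = valid′ ; encode≡ = encode≡ }
    with subst (λ e → _ ∈ toList e) encode≡ t∈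
  ...   | here refl = ℓ , ∈-++⁺ʳ pre (here refl) , refl
  ...   | there t∈′ with encode-⊆ valid′ t∈′
  ...     | r , r∈ , qr≡t = r , ∈-middle⁺ pre r∈ , qr≡t

  ⊆-encode : ∀ {l K q ρ r} → ValidForest l K q ρ → r ∈ K → q r ∈ toList (encode l K q)
  ⊆-encode {zero} {_ ∷ _} valid _ with () ← ValidForest.length≡ valid
  ⊆-encode {suc l} {q = q} valid r∈ with encodeStep valid
  ... | record { pre = pre ; K≡ = refl ; valid = valid′ ; encode≡ = encode≡ } rewrite encode≡
    with ∈-middle⁻ pre r∈
  ...   | inj₁ refl = here refl
  ...   | inj₂ r∈′  = there (⊆-encode valid′ r∈′)

  encode-outside : ∀ {l K q ρ} → ValidForest l K q ρ → LastOutside K (encode l K q)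
  encode-outside {zero} valid = tt
  encode-outside {suc l} {q = q} valid with encodeStep valid
  ... | record { pre = pre ; ℓ = ℓ ; post = post ; unused = unused ; K≡ = refl ; valid = valid′ ; encode≡ = encode≡ }
    rewrite encode≡ = outside (encode l (pre ++ post) q) (ValidForest.length≡ valid′) (encode-outside valid′) (encode-⊆ valid′)
    where
    ℓ-leaf : ∀ {r} → r ∈ pre ++ ℓ ∷ post → c (q r) ≢ ℓ
    ℓ-leaf r∈ = Unused⇒≢ unused (∈-map⁺ q r∈)
    outside : ∀ {l′} (e : Vec A l′) → length (pre ++ post) ≡ l′ → LastOutside (pre ++ post) e →
      (∀ {t} → t ∈ toList e → ∃ λ r → r ∈ pre ++ post × q r ≡ t) → c (Vec.last (q ℓ ∷ e)) ∉ pre ++ ℓ ∷ post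
    outside [] length≡0 _ _ cqℓ∈ with ∈-middle⁻ pre cqℓ∈
    ... | inj₁ cqℓ≡ℓ = ℓ-leaf (∈-++⁺ʳ pre (here refl)) cqℓ≡ℓ
    ... | inj₂ cqℓ∈′ = length≡0⇒∉ length≡0 cqℓ∈′
    outside (y ∷ e) _ out ⊆q c∈ with ⊆q (last∈toList (y ∷ e)) | ∈-middle⁻ pre c∈
    ... | r , r∈ , qr≡ | inj₁ c≡ℓ = ℓ-leaf (∈-middle⁺ pre r∈) (trans (cong c qr≡) c≡ℓ)
    ... | _            | inj₂ c∈′ = out c∈′

  encode-cong : ∀ l K {q q′} → (∀ {r} → r ∈ K → q r ≡ q′ r) → encode l K q ≡ encode l K q′
  encode-cong zero    K         _    = refl
  encode-cong (suc l) K {q} {q′} q≗q′ rewrite map-cong-local (All.tabulate q≗q′)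
    with firstSplit (unused? (map q′ K)) K in split
  ... | nothing = cong (⋆ ∷_) (encode-cong l K q≗q′)
  ... | just (pre , ℓ , post) with firstSplit-just (unused? (map q′ K)) K split
  ...   | refl , _ = cong₂ _∷_ (q≗q′ (∈-++⁺ʳ pre (here refl))) (encode-cong l (pre ++ post) (q≗q′ ∘ ∈-middle⁺ pre))

  encode-decode : ∀ {l K} {s : Vec A l} → ValidCode l K s → encode l K (decode l K s) ≡ s
  encode-decode {zero} {s = []} _ = refl
  encode-decode {suc l} {K} {x ∷ s} valid with decodeStep valid
  ... | record { pre = pre ; post = post ; ℓ = ℓ ; split = split ; K≡ = refl ; valid = valid′
               ; decode-ℓ = decode-ℓ ; decode-rest = decode-rest } = begin
    encode (suc l) K q                                      ≡⟨ encode-split same-split ⟩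
    q ℓ ∷ encode l (pre ++ post) q                          ≡⟨ cong₂ _∷_ decode-ℓ (encode-cong l (pre ++ post) decode-rest) ⟩
    x ∷ encode l (pre ++ post) (decode l (pre ++ post) s)  ≡⟨ cong (x ∷_) (encode-decode valid′) ⟩
    x ∷ s                                                   ∎
    where
    open ≡-Reasoning
    q = decode (suc l) K (x ∷ s)
    values⊆code : ∀ {t} → t ∈ map q K → t ∈ x ∷ toList s
    values⊆code t∈ with ∈-map⁻ q t∈
    ... | r , r∈ , refl = decode-∈ valid r∈
    code⊆values : ∀ {t} → t ∈ x ∷ toList s → t ∈ map q K
    code⊆values t∈ with ∈-decode valid t∈
    ... | r , r∈ , refl = ∈-map⁺ q r∈
    same-split : firstSplit (unused? (map q K)) K ≡ just (pre , ℓ , post)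
    same-split = trans (Unused-cong K values⊆code code⊆values) split

  decode-encode : ∀ {l K q ρ r} → ValidForest l K q ρ → r ∈ K → decode l K (encode l K q) r ≡ q r
  decode-encode {zero} {_ ∷ _} valid _ with () ← ValidForest.length≡ valid
  decode-encode {suc l} {K} {q} valid r∈ with encodeStep valid
  ... | record { pre = pre ; post = post ; ℓ = ℓ ; split = split ; K≡ = refl ; valid = valid′ ; encode≡ = encode≡ }
    rewrite encode≡ = decodes r∈
    where
    e = encode l (pre ++ post) q
    code⊆values : ∀ {t} → t ∈ q ℓ ∷ toList e → t ∈ map q K
    code⊆values (here refl) = ∈-map⁺ q (∈-++⁺ʳ pre (here refl))
    code⊆values (there t∈) with encode-⊆ valid′ t∈
    ... | r , r∈ , refl = ∈-map⁺ q (∈-middle⁺ pre r∈)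
    values⊆code : ∀ {t} → t ∈ map q K → t ∈ q ℓ ∷ toList e
    values⊆code t∈ with ∈-map⁻ q t∈
    ... | r , r∈ , refl with ∈-middle⁻ pre r∈
    ...   | inj₁ refl = here refl
    ...   | inj₂ r∈′  = there (⊆-encode valid′ r∈′)
    same-split : firstSplit (unused? (q ℓ ∷ toList e)) K ≡ just (pre , ℓ , post)
    same-split = trans (Unused-cong K code⊆values values⊆code) split
    decodes : ∀ {r} → r ∈ K → decode (suc l) K (q ℓ ∷ e) r ≡ q r
    decodes r∈ with ∈-middle⁻ pre r∈
    ... | inj₁ refl = Step.decode-ℓ K same-split
    ... | inj₂ r∈′  = trans (Step.decode-≢ℓ K same-split (∈-middle⇒≢ pre (ValidForest.unique valid) r∈′))
                            (decode-encode valid′ r∈′)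

-- σ-Prüfer sequences as equivariant parent functions

module NonRootCycles {m : ℕ} (σ : Permutation′ (suc m)) (σ-root : σ ⟨$⟩ʳ Fin.zero ≡ Fin.zero) where
  open Orbits σ

  N : ℕ
  N = suc m

  root : Fin N
  root = Fin.zero

  ^-root : ∀ j → σ ^[ j ] root ≡ root
  ^-root zero    = refl
  ^-root (suc j) = trans (cong (σ ⟨$⟩ʳ_) (^-root j)) σ-root

  root-isRep : IsCycleRep σ 1 root
  root-isRep = s≤s z≤n , σ-root , (λ { _ (s≤s _) (s≤s ()) }) , λ { zero _ → z≤n ; (suc _) (s≤s ()) }

  rep≢root : ∀ {v} → v ≢ root → rep v ≢ root
  rep≢root {v} v≢root rep≡root = v≢root (trans (sym (rep-reaches v)) (trans (cong (σ ^[ offset v ]_) rep≡root) (^-root (offset v))))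

  reps : ℕ → List (Fin N)
  reps d = filter (isCycleRep? σ d) (tabulate Fin.suc)

  ∈-reps⁺ : ∀ {d r} → IsCycleRep σ d r → r ≢ root → r ∈ reps d
  ∈-reps⁺ {r = Fin.zero}  _       r≢root = contradiction refl r≢root
  ∈-reps⁺ {r = Fin.suc i} r-isRep _      = ∈-filter⁺ (isCycleRep? σ _) (∈-tabulate⁺ i) r-isRep

  ∈-reps⁻ : ∀ {d r} → r ∈ reps d → IsCycleRep σ d r × r ≢ root
  ∈-reps⁻ {d} r∈ with ∈-filter⁻ (isCycleRep? σ d) r∈
  ... | r∈suc , r-isRep with ∈-tabulate⁻ {f = Fin.suc} r∈suc
  ...   | _ , refl = r-isRep , λ ()

  reps-unique : ∀ d → Unique (reps d)
  reps-unique d = Unique.filter⁺ (isCycleRep? σ d) (Unique.tabulate⁺ FinP.suc-injective)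

  length-reps≤ : ∀ d → length (reps d) ≤ N
  length-reps≤ d = ℕP.≤-trans (length-filter (isCycleRep? σ d) (tabulate Fin.suc))
                              (ℕP.≤-trans (ℕP.≤-reflexive (length-tabulate Fin.suc)) (ℕP.n≤1+n m))

  -- The root is the only 1-cycle missing from reps 1, and it is not a d-cycle for d ≥ 2.
  length-reps : ∀ d → 1 ≤ d → length (reps d) ≡ blockLen σ d
  length-reps (suc zero) _ =
    sym (cong (λ xs → length xs ∸ 1) (filter-accept (isCycleRep? σ 1) {xs = tabulate Fin.suc} root-isRep))
  length-reps (suc (suc d)) _ =
    sym (cong length (filter-reject (isCycleRep? σ (suc (suc d))) {xs = tabulate Fin.suc} root-not-isRep))
    where
    root-not-isRep : ¬ IsCycleRep σ (suc (suc d)) root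
    root-not-isRep (_ , _ , noEarlier , _) = noEarlier 1 (s≤s z≤n) (s≤s (s≤s z≤n)) σ-root

  Λ-along : ∀ a j {r} → σ ^[ a ] r ≡ r → InΛ σ a (σ ^[ j ] r)
  Λ-along a j {r} fix = trans (^-comm a j r) (cong (σ ^[ j ]_) fix)

  Λ-back : ∀ a j {r} → InΛ σ a (σ ^[ j ] r) → σ ^[ a ] r ≡ r
  Λ-back a j {r} fix = ^-injective j (trans (^-comm j a r) fix)

  InΛ-rep : ∀ a {t} → InΛ σ a t → InΛ σ a (rep t)
  InΛ-rep a {t} fix = Λ-back a (offset t) (subst (InΛ σ a) (sym (rep-reaches t)) fix)

  InΛ-period : ∀ t → InΛ σ (period t) t
  InΛ-period t = subst (InΛ σ (period t)) (rep-reaches t) (Λ-along (period t) (offset t) (proj₁ (proj₂ (rep-isRep t))))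

  InΛ′⇒rep∉ : ∀ d {t} → InΛ′ σ d t → rep t ∉ reps d
  InΛ′⇒rep∉ (suc zero) refl rep∈ = proj₂ (∈-reps⁻ rep∈) (proj₁ (rep-of-rep root-isRep))
  InΛ′⇒rep∉ (suc (suc d)) {t} (e , e∣d , e<d , fix) rep∈ =
    noEarlier e (1≤e e∣d) e<d (InΛ-rep e fix)
    where
    noEarlier = proj₁ (proj₂ (proj₂ (proj₁ (∈-reps⁻ rep∈))))
    1≤e : ∀ {e} → e ∣ suc (suc d) → 1 ≤ e
    1≤e {zero}  0∣d with () ← 0∣⇒≡0 0∣d
    1≤e {suc _} _ = s≤s z≤n

  period< : ∀ d {t} → 1 ≤ d → InΛ σ d t → rep t ∉ reps d → t ≢ root → period t < d
  period< (suc d) {t} _ fix rep∉ t≢root = ℕP.≤∧≢⇒< (∣⇒≤ (length-∣ (rep-isRep t) (InΛ-rep (suc d) fix)))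
    λ period≡d → rep∉ (∈-reps⁺ (subst (λ e → IsCycleRep σ e (rep t)) period≡d (rep-isRep t)) (rep≢root t≢root))

  rep∉⇒InΛ′ : ∀ d {t} → 1 ≤ d → InΛ σ d t → rep t ∉ reps d → InΛ′ σ d t
  rep∉⇒InΛ′ (suc zero) {t} 1≤d fix rep∉ with t ≟ root
  ... | yes t≡root = t≡root
  ... | no t≢root  = contradiction (period< 1 1≤d fix rep∉ t≢root) (ℕP.≤⇒≯ (1≤period t))
  rep∉⇒InΛ′ (suc (suc d)) {t} 1≤d fix rep∉ with t ≟ root
  ... | yes refl   = 1 , divides (suc (suc d)) (sym (ℕP.*-identityʳ _)) , s≤s (s≤s z≤n) , σ-root
  ... | no t≢root  = period t , length-∣ (rep-isRep t) (InΛ-rep (suc (suc d)) fix) , period< _ 1≤d fix rep∉ t≢root , InΛ-period t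

module PruferParents {m : ℕ} (σ : Permutation′ (suc m)) (σ-root : σ ⟨$⟩ʳ Fin.zero ≡ Fin.zero) where
  open Orbits σ
  open InvariantTrees σ σ-root
  open NonRootCycles σ σ-root
  open PruferCode _≟_ root rep
  open import Data.List.Membership.DecPropositional (_≟_ {N}) using (_∈?_)

  validBlock⇒ : ∀ d {l} (B : Vec (Fin N) l) → ValidBlock σ d B → All (InΛ σ d) (toList B) × LastOutside (reps d) B
  validBlock⇒ d []      _             = All.[] , tt
  validBlock⇒ d (x ∷ B) (all , last′) = VAll.toList⁺ all , InΛ′⇒rep∉ d last′

  ⇒validBlock : ∀ d {l} (B : Vec (Fin N) l) → 1 ≤ d → All (InΛ σ d) (toList B) → LastOutside (reps d) B → ValidBlock σ d B
  ⇒validBlock d []      _   _   _   = tt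
  ⇒validBlock d (x ∷ B) 1≤d all out = VAll.toList⁻ all , rep∉⇒InΛ′ d 1≤d (All.lookup all (last∈toList (x ∷ B))) out

  blockPeriod : Fin N → ℕ
  blockPeriod k = suc (toℕ k)

  -- Since period v ≤ N the reduction mod N does nothing; it only makes block total.
  block : Fin N → Fin N
  block v = (period v ∸ 1) mod N

  blockPeriod-block : ∀ v → blockPeriod (block v) ≡ period v
  blockPeriod-block v with period v | 1≤period v | period≤n v
  ... | suc p | _ | p<N = cong suc (trans (FinP.toℕ-fromℕ< _) (m<n⇒m%n≡m p<N))

  block-rep : ∀ {k r} → IsCycleRep σ (blockPeriod k) r → block r ≡ k
  block-rep {k} r-isRep = FinP.toℕ-injective (begin
    toℕ (block _)            ≡⟨ FinP.toℕ-fromℕ< _ ⟩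
    (period _ ∸ 1) % N       ≡⟨ cong (λ p → (p ∸ 1) % N) (proj₂ (rep-of-rep r-isRep)) ⟩
    toℕ k % N                ≡⟨ m<n⇒m%n≡m (FinP.toℕ<n k) ⟩
    toℕ k                    ∎)
    where open ≡-Reasoning

  block-cong : ∀ {u v} → period u ≡ period v → block u ≡ block v
  block-cong = cong (λ p → (p ∸ 1) mod N)

  block-^ : ∀ j v → block (σ ^[ j ] v) ≡ block v
  block-^ j v = block-cong (proj₂ (rep-^ j v))

  L : Fin N → ℕ
  L k = blockLen σ (blockPeriod k)

  K : Fin N → List (Fin N)
  K k = reps (blockPeriod k)

  length-K : ∀ k → length (K k) ≡ L k
  length-K k = length-reps (blockPeriod k) (s≤s z≤n)

  rep∈K : ∀ {v} → v ≢ root → rep v ∈ K (block v)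
  rep∈K {v} v≢root = ∈-reps⁺ (subst (λ d → IsCycleRep σ d (rep v)) (sym (blockPeriod-block v)) (rep-isRep v)) (rep≢root v≢root)

  lex-< : ∀ {a b y} w → a < b → y ≤ N → a * suc N + y < b * suc N + w
  lex-< {a} {b} {y} w a<b y≤N = begin-strict
    a * suc N + y      <⟨ ℕP.+-monoʳ-< (a * suc N) (s≤s y≤N) ⟩
    a * suc N + suc N  ≡⟨ ℕP.+-comm (a * suc N) (suc N) ⟩
    suc a * suc N      ≤⟨ ℕP.*-monoˡ-≤ (suc N) a<b ⟩
    b * suc N          ≤⟨ ℕP.m≤m+n (b * suc N) w ⟩
    b * suc N + w      ∎
    where open ℕP.≤-Reasoning

  module FromCode (S : PruferSeq σ) where
    open PruferSeq S renaming (blocks to B)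

    code-valid : ∀ k → ValidCode (L k) (K k) (B k)
    code-valid k = record
      { unique = reps-unique (blockPeriod k) ; length≡ = length-K k
      ; last-outside = proj₂ (validBlock⇒ (blockPeriod k) (B k) (valid k)) }

    choice : Fin N → Fin N → Fin N
    choice k = decode (L k) (K k) (B k)

    choiceRank : Fin N → Fin N → ℕ
    choiceRank k = rank (L k) (K k) (B k)

    choice-InΛ : ∀ k {r} → r ∈ K k → InΛ σ (blockPeriod k) (choice k r)
    choice-InΛ k r∈ = All.lookup (proj₁ (validBlock⇒ (blockPeriod k) (B k) (valid k))) (decode-∈ (code-valid k) r∈)

    choiceAt : Fin N → Fin N
    choiceAt v = choice (block v) (rep v)

    choiceAt-InΛ : ∀ {v} → v ≢ root → InΛ σ (period v) (choiceAt v)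
    choiceAt-InΛ {v} v≢root = subst (λ d → InΛ σ d (choiceAt v)) (blockPeriod-block v) (choice-InΛ (block v) (rep∈K v≢root))

    choiceAt-^ : ∀ j v → choiceAt (σ ^[ j ] v) ≡ choiceAt v
    choiceAt-^ j v = cong₂ choice (block-^ j v) (proj₁ (rep-^ j v))

    -- The parent of v = σ^j r is σ^j applied to the parent chosen for the cycle representative r.
    parent : Fin N → Fin N
    parent v with v ≟ root
    ... | yes _ = root
    ... | no _  = σ ^[ offset v ] (choiceAt v)

    -- Lexicographic in (period, rank): a parent has a smaller period or, in the same block, a smaller rank.
    depth : Fin N → ℕ
    depth v with v ≟ root
    ... | yes _ = 0
    ... | no _  = period v * suc N + choiceRank (block v) (rep v)

    parent-≢root : ∀ {v} → v ≢ root → parent v ≡ σ ^[ offset v ] (choiceAt v)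
    parent-≢root {v} v≢root with v ≟ root
    ... | yes v≡root = contradiction v≡root v≢root
    ... | no _       = refl

    depth-≢root : ∀ {v} → v ≢ root → depth v ≡ period v * suc N + choiceRank (block v) (rep v)
    depth-≢root {v} v≢root with v ≟ root
    ... | yes v≡root = contradiction v≡root v≢root
    ... | no _       = refl

    parent-root : parent root ≡ root
    parent-root with root ≟ root
    ... | yes _          = refl
    ... | no root≢root  = contradiction refl root≢root

    parent-σ : ∀ v → parent (σ ⟨$⟩ʳ v) ≡ σ ⟨$⟩ʳ parent v
    parent-σ v with v ≟ root
    ... | yes refl   = trans (cong parent σ-root) (trans parent-root (sym σ-root))
    ... | no v≢root = begin
      parent (σ ⟨$⟩ʳ v)                                ≡⟨ parent-≢root (σ≢root v≢root) ⟩
      σ ^[ offset (σ ⟨$⟩ʳ v) ] (choiceAt (σ ⟨$⟩ʳ v))  ≡⟨ cong (σ ^[ offset (σ ⟨$⟩ʳ v) ]_) (choiceAt-^ 1 v) ⟩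
      σ ^[ offset (σ ⟨$⟩ʳ v) ] (choiceAt v)            ≡⟨ ^-transfer (offset (σ ⟨$⟩ʳ v)) (suc (offset v)) (rep-isRep v)
                                                              (choiceAt-InΛ v≢root) same-position ⟩
      σ ⟨$⟩ʳ (σ ^[ offset v ] (choiceAt v))            ∎
      where
      open ≡-Reasoning
      same-position : σ ^[ offset (σ ⟨$⟩ʳ v) ] (rep v) ≡ σ ⟨$⟩ʳ (σ ^[ offset v ] (rep v))
      same-position = trans (subst (λ r → σ ^[ offset (σ ⟨$⟩ʳ v) ] r ≡ σ ⟨$⟩ʳ v) (proj₁ (rep-^ 1 v))
                                   (rep-reaches (σ ⟨$⟩ʳ v)))
                            (cong (σ ⟨$⟩ʳ_) (sym (rep-reaches v)))

    depth-σ : ∀ v → depth (σ ⟨$⟩ʳ v) ≡ depth v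
    depth-σ v with v ≟ root
    ... | yes refl   = cong depth σ-root
    ... | no v≢root = trans (depth-≢root (σ≢root v≢root))
      (cong₂ (λ p k → p * suc N + k) (proj₂ (rep-^ 1 v)) (cong₂ choiceRank (block-^ 1 v) (proj₁ (rep-^ 1 v))))

    choiceRank≤N : ∀ {v} → v ≢ root → choiceRank (block v) (rep v) ≤ N
    choiceRank≤N {v} v≢root = ℕP.≤-trans (rank≤ (code-valid (block v)) (rep∈K v≢root))
      (ℕP.≤-trans (ℕP.≤-reflexive (sym (length-K (block v)))) (length-reps≤ (blockPeriod (block v))))

    0<depth : ∀ {v} → v ≢ root → 0 < depth v
    0<depth {v} v≢root = subst (0 <_) (sym (depth-≢root v≢root))
      (ℕP.<-≤-trans (s≤s z≤n) (ℕP.≤-trans (ℕP.*-monoˡ-≤ (suc N) (1≤period v)) (ℕP.m≤m+n _ _)))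

    depth-root : depth root ≡ 0
    depth-root with root ≟ root
    ... | yes _         = refl
    ... | no root≢root = contradiction refl root≢root

    module _ {v} (v≢root : v ≢ root) (p≢root : parent v ≢ root) where
      private
        x = choiceAt v
        p = parent v
        p-onCycle : rep p ≡ rep x × period p ≡ period x
        p-onCycle = subst (λ t → rep t ≡ rep x × period t ≡ period x) (sym (parent-≢root v≢root)) (rep-^ (offset v) x)

      depth-parent-sameBlock : rep x ∈ K (block v) → depth p < depth v
      depth-parent-sameBlock rep-x∈ = begin-strict
        depth p                                                  ≡⟨ depth-≢root p≢root ⟩
        period p * suc N + choiceRank (block p) (rep p)          ≡⟨ cong₂ (λ d r → d * suc N + r) period-p
                                                                      (cong₂ choiceRank (block-cong period-p) (proj₁ p-onCycle)) ⟩
        period v * suc N + choiceRank (block v) (rep x)          <⟨ ℕP.+-monoʳ-< (period v * suc N)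
                                                                      (rank-descends (code-valid (block v)) (rep∈K v≢root) rep-x∈) ⟩
        period v * suc N + choiceRank (block v) (rep v)          ≡⟨ depth-≢root v≢root ⟨
        depth v                                                  ∎
        where
        open ℕP.≤-Reasoning
        period-p : period p ≡ period v
        period-p = trans (proj₂ p-onCycle) (trans (length-unique (rep-isRep x) (proj₁ (∈-reps⁻ rep-x∈))) (blockPeriod-block v))

      depth-parent-lowerBlock : rep x ∉ K (block v) → depth p < depth v
      depth-parent-lowerBlock rep-x∉ = subst₂ _<_ (sym (depth-≢root p≢root)) (sym (depth-≢root v≢root))
        (lex-< _ (subst (_< period v) (sym (proj₂ p-onCycle)) period-x<) (choiceRank≤N p≢root))
        where
        x≢root : x ≢ root
        x≢root x≡root = p≢root (trans (parent-≢root v≢root) (trans (cong (σ ^[ offset v ]_) x≡root) (^-root (offset v))))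
        period-x< : period x < period v
        period-x< = subst (period x <_) (blockPeriod-block v)
          (period< (blockPeriod (block v)) (s≤s z≤n) (choice-InΛ (block v) (rep∈K v≢root)) rep-x∉ x≢root)

    depth-parent : ∀ v → v ≢ root → depth (parent v) < depth v
    depth-parent v v≢root = by-cases (parent v ≟ root) (rep (choiceAt v) ∈? K (block v))
      where
      by-cases : Dec (parent v ≡ root) → Dec (rep (choiceAt v) ∈ K (block v)) → depth (parent v) < depth v
      by-cases (yes p≡root) _ = subst (_< depth v) (sym (trans (cong depth p≡root) depth-root)) (0<depth v≢root)
      by-cases (no p≢root) (yes rep-x∈) = depth-parent-sameBlock v≢root p≢root rep-x∈
      by-cases (no p≢root) (no rep-x∉)  = depth-parent-lowerBlock v≢root p≢root rep-x∉

    toParent : EquivariantParent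
    toParent = record
      { parentFunction = record { parent = parent ; parent-root = parent-root ; depth = depth ; depth-parent = depth-parent }
      ; parent-σ = parent-σ
      ; depth-σ  = depth-σ }

  module FromParent (P : EquivariantParent) where
    open EquivariantParent P

    parent-^ : ∀ j v → parent (σ ^[ j ] v) ≡ σ ^[ j ] (parent v)
    parent-^ zero    v = refl
    parent-^ (suc j) v = trans (parent-σ (σ ^[ j ] v)) (cong (σ ⟨$⟩ʳ_) (parent-^ j v))

    depth-^ : ∀ j v → depth (σ ^[ j ] v) ≡ depth v
    depth-^ zero    v = refl
    depth-^ (suc j) v = trans (depth-σ (σ ^[ j ] v)) (depth-^ j v)

    depth-rep : ∀ v → depth (rep v) ≡ depth v
    depth-rep v = trans (sym (depth-^ (offset v) (rep v))) (cong depth (rep-reaches v))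

    forest-valid : ∀ k → ValidForest (L k) (K k) parent depth
    forest-valid k = record
      { unique  = reps-unique (blockPeriod k)
      ; length≡ = length-K k
      ; ranked  = λ {r} r∈ _ → subst (_< depth r) (sym (depth-rep (parent r))) (depth-parent r (proj₂ (∈-reps⁻ r∈))) }

    parent-InΛ : ∀ k {r} → r ∈ K k → InΛ σ (blockPeriod k) (parent r)
    parent-InΛ k {r} r∈ = trans (sym (parent-^ (blockPeriod k) r)) (cong parent (proj₁ (proj₂ (proj₁ (∈-reps⁻ r∈)))))

    blocks : Blocks σ
    blocks k = encode (L k) (K k) parent

    blocks-InΛ : ∀ k → All (InΛ σ (blockPeriod k)) (toList (blocks k))
    blocks-InΛ k = All.tabulate λ t∈ → case-encoded (encode-⊆ (forest-valid k) t∈)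
      where
      case-encoded : ∀ {t} → ∃ (λ r → r ∈ K k × parent r ≡ t) → InΛ σ (blockPeriod k) t
      case-encoded (r , r∈ , refl) = parent-InΛ k r∈

    toCode : PruferSeq σ
    toCode = record
      { blocks = blocks
      ; valid  = λ k → ⇒validBlock (blockPeriod k) (blocks k) (s≤s z≤n) (blocks-InΛ k) (encode-outside (forest-valid k)) }

  toParent : PruferSeq σ → EquivariantParent
  toParent = FromCode.toParent

  toCode : EquivariantParent → PruferSeq σ
  toCode = FromParent.toCode

  toParent-cong : ∀ {S S′} → (∀ k → PruferSeq.blocks S k ≡ PruferSeq.blocks S′ k) →
    ∀ v → EquivariantParent.parent (toParent S) v ≡ EquivariantParent.parent (toParent S′) v
  toParent-cong {S} {S′} S≈S′ v with v ≟ root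
  ... | yes _ = refl
  ... | no _  = cong (λ b → σ ^[ offset v ] (decode (L (block v)) (K (block v)) b (rep v))) (S≈S′ (block v))

  toCode-cong : ∀ {P Q} → (∀ v → EquivariantParent.parent P v ≡ EquivariantParent.parent Q v) →
    ∀ k → PruferSeq.blocks (toCode P) k ≡ PruferSeq.blocks (toCode Q) k
  toCode-cong P≈Q k = encode-cong (L k) (K k) (λ {r} _ → P≈Q r)

  toCode-toParent : ∀ S k → PruferSeq.blocks (toCode (toParent S)) k ≡ PruferSeq.blocks S k
  toCode-toParent S k = trans (encode-cong (L k) (K k) parent≡choice) (encode-decode (code-valid k))
    where
    open FromCode S
    parent≡choice : ∀ {r} → r ∈ K k → parent r ≡ choice k r
    parent≡choice {r} r∈ with ∈-reps⁻ r∈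
    ... | r-isRep , r≢root = begin
      parent r                         ≡⟨ parent-≢root r≢root ⟩
      σ ^[ offset r ] (choiceAt r)     ≡⟨ cong (σ ^[ offset r ]_) (cong₂ choice (block-rep r-isRep) (proj₁ (rep-of-rep r-isRep))) ⟩
      σ ^[ offset r ] (choice k r)     ≡⟨ ^-transfer (offset r) 0 r-isRep (choice-InΛ k r∈) offset-r ⟩
      choice k r                       ∎
      where
      open ≡-Reasoning
      offset-r : σ ^[ offset r ] r ≡ r
      offset-r = subst (λ t → σ ^[ offset r ] t ≡ r) (proj₁ (rep-of-rep r-isRep)) (rep-reaches r)

  toParent-toCode : ∀ P v → EquivariantParent.parent (toParent (toCode P)) v ≡ EquivariantParent.parent P v
  toParent-toCode P v with v ≟ root
  ... | yes refl   = sym (EquivariantParent.parent-root P)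
  ... | no v≢root = begin
    σ ^[ offset v ] (decode (L (block v)) (K (block v)) (encode (L (block v)) (K (block v)) parent) (rep v))
      ≡⟨ cong (σ ^[ offset v ]_) (decode-encode (forest-valid (block v)) (rep∈K v≢root)) ⟩
    σ ^[ offset v ] (parent (rep v))  ≡⟨ parent-^ (offset v) (rep v) ⟨
    parent (σ ^[ offset v ] (rep v))  ≡⟨ cong parent (rep-reaches v) ⟩
    parent v                          ∎
    where
    open ≡-Reasoning
    open EquivariantParent P
    open FromParent P

  codes↔parents : Inverse (PruferSetoid σ) ParentSetoid
  codes↔parents = record
    { to        = toParent
    ; from      = toCode
    ; to-cong   = λ {S} {S′} → toParent-cong {S} {S′}
    ; from-cong = λ {P} {Q} → toCode-cong {P} {Q}
    ; inverse   = (λ {P} {S} S≈toCode-P v → trans (toParent-cong {S} {toCode P} S≈toCode-P v) (toParent-toCode P v))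
                , (λ {S} {P} P≈toParent-S k → trans (toCode-cong {P} {toParent S} P≈toParent-S k) (toCode-toParent S k))
    }

mainTheorem4 : (m : ℕ) (σ : Permutation′ (ℕ.suc m)) →
    σ ⟨$⟩ʳ Fin.zero ≡ Fin.zero →
    Inverse (PruferSetoid σ) (TreeSetoid σ)
mainTheorem4 m σ σ-root = Compose.inverse (PruferParents.codes↔parents σ σ-root) (InvariantTrees.parents↔trees σ σ-root)
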